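{- For every integer $m\geq 1$: (1) $\mathrm{DWD}_m = [x_m,y_m]$, i.e. the set of dyadically well-distributed permutations in $S_{2^m}$ is exactly the Bruhat interval $\{z\in S_{2^m} : x_m\le z\le y_m\}$; (2) the map $\varphi$ defined in the context is an isomorphism of posets between $[x_m,y_m]$ (with the Bruhat order) and $S_2^{\mathcal{C}_m}$ (with the componentwise order); (3) consequently the Bruhat interval $[x_m,y_m]$ is poset-isomorphic to a Boolean lattice (hypercube) of rank $m2^{m-1}$.
   Context: Let $[n]=\{0,1,\dots,n-1\}$ and let $S_n$ be the group of bijections of $[n]$. Fix $m\ge 1$ and $n=2^m$. Identify $\mathbb{F}_2^m$ with $[2^m]$ via $(a_0,\dots,a_{m-1})\mapsto \sum_{i=0}^{m-1}a_i2^{m-1-i}$ (so the usual order on $[2^m]$ is the lexicographic order on bit strings). For $0\le k\le m$, a basic $k$-interval is a set of the form $\{c2^k,\dots,(c+1)2^k-1\}\subseteq[2^m]$; equivalently, the set of $m$-bit strings with a fixed prefix of length $m-k$. A permutation $\pi\in S_{2^m}$ is dyadically well-distributed if for every basic $k_1$-interval $S$ and basic $k_2$-interval $T$ with $k_1+k_2=m$ there is exactly one $i\in S$ with $\pi(i)\in T$; $\mathrm{DWD}_m$ denotes the set of such permutations. Define $x_1=(0,1)$ in one-line notation and inductively $x_{m+1}=(x_m(0),x_m(0)+2^m,x_m(1),x_m(1)+2^m,\dots,x_m(2^m-1),x_m(2^m-1)+2^m)\in S_{2^{m+1}}$ (equivalently $x_m$ reverses the bit string $(a_0,\dots,a_{m-1})\mapsto(a_{m-1},\dots,a_0)$),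 and let $y_m=(x_m(2^m-1),\dots,x_m(1),x_m(0))$ be its reverse in one-line notation. The length $\ell(\pi)$ is the number of inversions $\#\{(i,j): i<j,\ \pi(i)>\pi(j)\}$, and the Bruhat order is: $\pi_1\le\pi_2$ iff there are transpositions $t_1,\dots,t_k$ with $\pi_1t_1\cdots t_k=\pi_2$ and $\ell(\pi_1t_1\cdots t_{s-1})<\ell(\pi_1t_1\cdots t_s)$ for all $1\le s\le k$. A complementary pair is a pair $(S,T)$ with $S$ a basic $k_1$-interval and $T$ a basic $k_2$-interval, $k_1+k_2=m+1$, $k_1,k_2\ge1$; $\mathcal{C}_m$ is the set of complementary pairs (it has $m2^{m-1}$ elements). For $\pi\in\mathrm{DWD}_m$ and $(S,T)\in\mathcal{C}_m$ there are exactly two elements $a<b$ of $S$ with $\pi(a),\pi(b)\in T$; set $\varphi(\pi)(S,T)=e$ if $\pi(a)<\pi(b)$ and $\varphi(\pi)(S,T)=s$ if $\pi(a)>\pi(b)$. This defines $\varphi:\mathrm{DWD}_m\to S_2^{\mathcal{C}_m}$, where $S_2=\{e,s\}$ and $S_2^{\mathcal{C}_m}$ (functions $\mathcal{C}_m\to S_2$) is ordered componentwise with $e<s$. -}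

module Defs where

open import Data.Nat using (ℕ; zero; suc; _+_; _*_; _∸_; _^_; _≤_; _<_; s≤s)
open import Data.Nat.Properties using (≤-pred; *-monoˡ-≤; +-mono-<-≤)
import Data.Nat.Properties as ℕP
open import Data.Nat.DivMod using (_/_; _%_; m%n<n)
open import Data.Fin using (Fin; toℕ; fromℕ<; opposite)
import Data.Fin.Properties as FinP
open import Data.Fin.Permutation using (Permutation′; _⟨$⟩ʳ_)
open import Data.Fin.Permutation.Components using (transpose)
open import Data.Bool using (Bool; true; false; _∧_; _∨_)
import Data.Bool as B
open import Data.List using (List; allFin; filter; length; map)
open import Data.Nat.ListAction using (sum)
open import Data.Bool.ListAction using (any)
open import Data.Product using (Σ; _×_; _,_; ∃!; proj₁)
open import Relation.Nullary using (does; _×-dec_)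
open import Relation.Binary.PropositionalEquality using (_≡_)
open import Function using (_∘_)

-- Permutations of [n] are represented by (the underlying functions of)
-- Data.Fin.Permutation.Permutation′ n.  Relations below are stated on
-- plain functions Fin n → Fin n; equality is pointwise.

_≐_ : ∀ {n} → (Fin n → Fin n) → (Fin n → Fin n) → Set
f ≐ g = ∀ i → f i ≡ g i

inv : ∀ {n} → (Fin n → Fin n) → ℕ
inv {n} π = sum (map (λ i → length (filter (λ j → i FinP.<? j ×-dec π j FinP.<? π i) (allFin n))) (allFin n))

-- Bruhat order: π₁ ≤ π₂ iff π₁ t₁ ⋯ t_k = π₂ for transpositions t_s with
-- the length strictly increasing at each step (k = 0 allowed).
-- Here π t = π ∘ t (t acts on positions).
data _≤B_ {n : ℕ} : (Fin n → Fin n) → (Fin n → Fin n) → Set where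
  done : ∀ {f g} → f ≐ g → f ≤B g
  step : ∀ {f g} (i j : Fin n) →
         inv f < inv (f ∘ transpose i j) → (f ∘ transpose i j) ≤B g → f ≤B g

InI : ∀ {n} → ℕ → ℕ → Fin n → Set
InI k c i = c * 2 ^ k ≤ toℕ i × toℕ i < suc c * 2 ^ k

inI? : ∀ {n} (k c : ℕ) (i : Fin n) → Bool
inI? k c i = does (c * 2 ^ k ℕP.≤? toℕ i ×-dec toℕ i ℕP.<? suc c * 2 ^ k)

DWD : (m : ℕ) → (Fin (2 ^ m) → Fin (2 ^ m)) → Set
DWD m π = ∀ k₁ k₂ → k₁ + k₂ ≡ m → ∀ c₁ c₂ → c₁ < 2 ^ (m ∸ k₁) → c₂ < 2 ^ (m ∸ k₂) →
          ∃! _≡_ (λ i → InI k₁ c₁ i × InI k₂ c₂ (π i))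

rev : ℕ → ℕ → ℕ
rev zero    i = 0
rev (suc m) i = rev m (i / 2) + (i % 2) * 2 ^ m

rev< : ∀ m i → rev m i < 2 ^ m
rev< zero    i = s≤s Data.Nat.z≤n
rev< (suc m) i = +-mono-<-≤ (rev< m (i / 2)) (*-monoˡ-≤ (2 ^ m) (≤-pred (m%n<n i 2)))

xPerm : (m : ℕ) → Fin (2 ^ m) → Fin (2 ^ m)
xPerm m i = fromℕ< (rev< m (toℕ i))

yPerm : (m : ℕ) → Fin (2 ^ m) → Fin (2 ^ m)
yPerm m i = xPerm m (opposite i)

record CPair (m : ℕ) : Set where
  constructor cpair
  field
    k₁ k₂ : ℕ
    sum≡  : k₁ + k₂ ≡ suc m
    1≤k₁  : 1 ≤ k₁
    1≤k₂  : 1 ≤ k₂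
    c₁    : ℕ
    c₁<   : c₁ < 2 ^ (m ∸ k₁)
    c₂    : ℕ
    c₂<   : c₂ < 2 ^ (m ∸ k₂)

-- φ(π)(S,T): e = false, s = true.  φ(π)(S,T) = s iff the elements a < b of S
-- with π a, π b ∈ T satisfy π a > π b.
φ₀ : (m : ℕ) → (Fin (2 ^ m) → Fin (2 ^ m)) → CPair m → Bool
φ₀ m π (cpair k₁ k₂ _ _ _ c₁ _ c₂ _) =
  any (λ a → any (λ b →
        does (a FinP.<? b) ∧ inI? k₁ c₁ a ∧ inI? k₁ c₁ b ∧
        inI? k₂ c₂ (π a) ∧ inI? k₂ c₂ (π b) ∧ does (π b FinP.<? π a))
      (allFin (2 ^ m)))
    (allFin (2 ^ m))

Interval : ℕ → Set
Interval m = Σ (Permutation′ (2 ^ m)) (λ z → xPerm m ≤B (z ⟨$⟩ʳ_) × (z ⟨$⟩ʳ_) ≤B yPerm m)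

_≈I_ : ∀ {m} → Interval m → Interval m → Set
(z , _) ≈I (w , _) = (z ⟨$⟩ʳ_) ≐ (w ⟨$⟩ʳ_)

_≤I_ : ∀ {m} → Interval m → Interval m → Set
(z , _) ≤I (w , _) = (z ⟨$⟩ʳ_) ≤B (w ⟨$⟩ʳ_)

φ : (m : ℕ) → Interval m → CPair m → Bool
φ m (z , _) = φ₀ m (z ⟨$⟩ʳ_)

-- S₂^X : functions X → Bool, componentwise order with e = false < s = true
_≈F_ : ∀ {X : Set} → (X → Bool) → (X → Bool) → Set
f ≈F g = ∀ c → f c ≡ g c

_≤F_ : ∀ {X : Set} → (X → Bool) → (X → Bool) → Set
f ≤F g = ∀ c → f c B.≤ g c

module Submission where

-- The rank r π x t = #{i < x ∣ t ≤ π i} can only grow along a Bruhat step, because a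
-- length-increasing transposition swaps an ascent. A permutation is DWD exactly when its rank at
-- every grid point (c₁ 2^k₁, c₂ 2^k₂), k₁ + k₂ = m, has the value forced by the definition; x_m
-- and y_m are DWD, so everything in [x_m, y_m] is DWD.
-- For a complementary pair (S, T) of a DWD permutation, φ says whether the lower half of S sends
-- a point into the upper half of T. By the rectangle identity this is governed by the rank at
-- the one corner of that quarter which is not a grid point, so φ is monotone. If the bit is e,
-- swapping the two points of S that land in T is a Bruhat step that keeps π DWD and flips only
-- this bit. Starting from x_m (all bits e) every pattern is reached this way, and φ is injective
-- on DWD permutations since the bits determine π i one binary digit at a time; y_m has all bits
-- s.

open import Defs
open import Data.Nat using (ℕ; zero; suc; _+_; _*_; _∸_; _^_; _≤_; _<_; _≤?_; _<?_; _≤ᵇ_; _<ᵇ_; s≤s; z≤n; NonZero)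
open import Data.Nat.Properties
open import Data.Nat.DivMod using (_/_; _%_; m%n<n; m≡m%n+[m/n]*n; m/n*n≤m; [m+kn]%n≡m%n; m<n⇒m%n≡m; m<n*o⇒m/o<n)
open import Data.Nat.Tactic.RingSolver using (solve-∀)
import Data.Nat.ListAction as ListSum
open import Algebra.Properties.CommutativeMonoid.Sum +-0-commutativeMonoid using (sum; sum-cong-≗; ∑-distrib-+)
open import Data.Fin using (Fin; toℕ; fromℕ<; opposite) renaming (zero to fzero; suc to fsuc)
import Data.Fin.Properties as Finₚ
open import Data.Fin.Permutation using (Permutation′; _⟨$⟩ʳ_; _∘ₚ_; permutation) renaming (transpose to transposition)
open import Data.Fin.Permutation.Components using (transpose; transpose-inverse)
open import Data.Bool using (Bool; true; false; T; T?; _∧_; _∨_; not; if_then_else_)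
import Data.Bool as Bool
open import Data.Bool.Properties using (∧-distribʳ-∨; ∧-distribˡ-∨; T-∨; T-∧)
import Data.Bool.Properties as Boolₚ
open import Data.List using (List; []; _∷_; map; filter; length; tabulate; allFin)
open import Data.List.Relation.Unary.Any using (here; there; satisfied)
open import Data.List.Relation.Unary.Any.Properties using (any⁺; any⁻)
open import Data.List.Membership.Propositional using (_∈_; lose)
open import Data.List.Membership.Propositional.Properties using (∈-map⁺; ∈-allFin)
open import Data.Product using (_×_; _,_; ∃; ∃₂; ∃!; proj₁; proj₂; uncurry)
open import Data.Sum using (_⊎_; inj₁; inj₂; [_,_]′)
open import Data.Empty using (⊥; ⊥-elim)
open import Relation.Nullary using (¬_; Dec; yes; no; does; _×-dec_)
open import Relation.Nullary.Decidable using (dec-true; dec-false; decidable-stable)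
open import Relation.Unary using (Decidable)
open import Relation.Binary.PropositionalEquality
open import Relation.Binary.Definitions using (tri<; tri≈; tri>)
open import Relation.Binary.Morphism.Structures using (IsOrderIsomorphism)
open import Function using (_∘_; _∘′_; id)
open import Function.Bundles using (_⇔_; mk⇔; Equivalence)
open import Function.Properties.Equivalence using () renaming (sym to ⇔-sym; trans to ⇔-trans)

𝟙 : Bool → ℕ
𝟙 false = 0
𝟙 true  = 1

𝟙-T : ∀ {b} → T b → 𝟙 b ≡ 1
𝟙-T {true} _ = refl

𝟙-¬T : ∀ {b} → ¬ T b → 𝟙 b ≡ 0
𝟙-¬T {false} _  = refl
𝟙-¬T {true}  ¬b = ⊥-elim (¬b _)

𝟙-∨ : ∀ a b → (T a → T b → ⊥) → 𝟙 (a ∨ b) ≡ 𝟙 a + 𝟙 b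
𝟙-∨ false b _ = refl
𝟙-∨ true false _ = refl
𝟙-∨ true true disjoint = ⊥-elim (disjoint _ _)

𝟙-mono : ∀ {a b} → (T a → T b) → 𝟙 a ≤ 𝟙 b
𝟙-mono {false} _ = z≤n
𝟙-mono {true} {true} _ = ≤-refl
𝟙-mono {true} {false} a⇒b = ⊥-elim (a⇒b _)

𝟙-rearrange : ∀ a b u v → (T b → T a) → (T u → T v) →
              𝟙 (a ∧ v) + 𝟙 (b ∧ u) ≡ 𝟙 (a ∧ u) + 𝟙 (b ∧ v) + 𝟙 ((a ∧ not b) ∧ (v ∧ not u))
𝟙-rearrange false false u v _ _ = refl
𝟙-rearrange false true u v b⇒a _ = ⊥-elim (b⇒a _)
𝟙-rearrange true true u v _ _ = trans (+-comm (𝟙 v) (𝟙 u)) (sym (+-identityʳ _))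
𝟙-rearrange true false false false _ _ = refl
𝟙-rearrange true false false true _ _ = refl
𝟙-rearrange true false true true _ _ = refl
𝟙-rearrange true false true false _ u⇒v = ⊥-elim (u⇒v _)

𝟙-rearrange-≤ : ∀ {a b u v} → (T b → T a) → (T u → T v) →
                𝟙 (b ∧ v) + 𝟙 (a ∧ u) ≤ 𝟙 (b ∧ u) + 𝟙 (a ∧ v)
𝟙-rearrange-≤ {a} {b} {u} {v} b⇒a u⇒v = begin
  𝟙 (b ∧ v) + 𝟙 (a ∧ u)                                     ≡⟨ +-comm (𝟙 (b ∧ v)) (𝟙 (a ∧ u)) ⟩
  𝟙 (a ∧ u) + 𝟙 (b ∧ v)                                     ≤⟨ m≤m+n _ _ ⟩
  𝟙 (a ∧ u) + 𝟙 (b ∧ v) + 𝟙 ((a ∧ not b) ∧ (v ∧ not u))    ≡⟨ 𝟙-rearrange a b u v b⇒a u⇒v ⟨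
  𝟙 (a ∧ v) + 𝟙 (b ∧ u)                                     ≡⟨ +-comm (𝟙 (a ∧ v)) (𝟙 (b ∧ u)) ⟩
  𝟙 (b ∧ u) + 𝟙 (a ∧ v)                                     ∎
  where open ≤-Reasoning

T-ext : ∀ {a b} → (T a → T b) → (T b → T a) → a ≡ b
T-ext {false} {false} _   _   = refl
T-ext {false} {true}  _   b⇒a = ⊥-elim (b⇒a _)
T-ext {true}  {false} a⇒b _   = ⊥-elim (a⇒b _)
T-ext {true}  {true}  _   _   = refl

T-≡true : ∀ {b} → T b → b ≡ true
T-≡true {true} _ = refl

¬T-≡false : ∀ {b} → ¬ T b → b ≡ false
¬T-≡false {false} _  = refl
¬T-≡false {true}  ¬b = ⊥-elim (¬b _)

T-∧⁻ : ∀ {a b} → T (a ∧ b) → T a × T b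
T-∧⁻ = Equivalence.to T-∧

T-∧⁺ : ∀ {a b} → T a → T b → T (a ∧ b)
T-∧⁺ Ta Tb = Equivalence.from T-∧ (Ta , Tb)

T-not : ∀ {b} → ¬ T b → T (not b)
T-not {false} _  = _
T-not {true}  ¬b = ⊥-elim (¬b _)

not-T : ∀ {b} → T (not b) → ¬ T b
not-T {true} () _

∧-cong-if : ∀ a {b c} → (T a → b ≡ c) → a ∧ b ≡ a ∧ c
∧-cong-if false _   = refl
∧-cong-if true  b≡c = b≡c _

∧-disjointʳ : ∀ {a b} c → (T a → T b → ⊥) → T (a ∧ c) → T (b ∧ c) → ⊥
∧-disjointʳ {true} {true} c disjoint _ _ = disjoint _ _

∧-disjointˡ : ∀ {a b} c → (T a → T b → ⊥) → T (c ∧ a) → T (c ∧ b) → ⊥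
∧-disjointˡ {a} {b} true disjoint = disjoint

T⇒≤ : ∀ {x y} → (T x → T y) → x Bool.≤ y
T⇒≤ {false} {false} _ = Bool.b≤b
T⇒≤ {false} {true}  _ = Bool.f≤t
T⇒≤ {true}  {true}  _ = Bool.b≤b
T⇒≤ {true}  {false} x⇒y = ⊥-elim (x⇒y _)

≤⇒T : ∀ {x y} → x Bool.≤ y → T x → T y
≤⇒T Bool.b≤b Tx = Tx

_∈[_,_[ : ℕ → ℕ → ℕ → Bool
y ∈[ a , b [ = (a ≤ᵇ y) ∧ (y <ᵇ b)

∈[[⇒ : ∀ a b y → T (y ∈[ a , b [) → a ≤ y × y < b
∈[[⇒ a b y y∈ = let (a≤y , y<b) = T-∧⁻ y∈ in ≤ᵇ⇒≤ a y a≤y , <ᵇ⇒< y b y<b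

⇒∈[[ : ∀ {a b y} → a ≤ y → y < b → T (y ∈[ a , b [)
⇒∈[[ a≤y y<b = T-∧⁺ (≤⇒≤ᵇ a≤y) (<⇒<ᵇ y<b)

<ᵇ-irrefl : ∀ x → ¬ T (x <ᵇ x)
<ᵇ-irrefl x x<x = <-irrefl refl (<ᵇ⇒< x x x<x)

<ᵇ-split : ∀ {x₀ x₁} → x₀ ≤ x₁ → ∀ y → (y <ᵇ x₁) ≡ (y <ᵇ x₀) ∨ y ∈[ x₀ , x₁ [
<ᵇ-split {x₀} {x₁} x₀≤x₁ y = T-ext to from
  where
  to : T (y <ᵇ x₁) → T ((y <ᵇ x₀) ∨ y ∈[ x₀ , x₁ [)
  to y<x₁ with y <? x₀
  ... | yes y<x₀ = Equivalence.from T-∨ (inj₁ (<⇒<ᵇ y<x₀))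
  ... | no y≮x₀  = Equivalence.from T-∨ (inj₂ (⇒∈[[ (≮⇒≥ y≮x₀) (<ᵇ⇒< y x₁ y<x₁)))
  from : T ((y <ᵇ x₀) ∨ y ∈[ x₀ , x₁ [) → T (y <ᵇ x₁)
  from y∈ with Equivalence.to T-∨ y∈
  ... | inj₁ y<x₀ = <⇒<ᵇ (<-≤-trans (<ᵇ⇒< y x₀ y<x₀) x₀≤x₁)
  ... | inj₂ y∈I  = <⇒<ᵇ (proj₂ (∈[[⇒ x₀ x₁ y y∈I))

≤ᵇ-split : ∀ {t₀ t₁} → t₀ ≤ t₁ → ∀ y → (t₀ ≤ᵇ y) ≡ y ∈[ t₀ , t₁ [ ∨ (t₁ ≤ᵇ y)
≤ᵇ-split {t₀} {t₁} t₀≤t₁ y = T-ext to from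
  where
  to : T (t₀ ≤ᵇ y) → T (y ∈[ t₀ , t₁ [ ∨ (t₁ ≤ᵇ y))
  to t₀≤y with y <? t₁
  ... | yes y<t₁ = Equivalence.from T-∨ (inj₁ (⇒∈[[ (≤ᵇ⇒≤ t₀ y t₀≤y) y<t₁))
  ... | no y≮t₁  = Equivalence.from T-∨ (inj₂ (≤⇒≤ᵇ (≮⇒≥ y≮t₁)))
  from : T (y ∈[ t₀ , t₁ [ ∨ (t₁ ≤ᵇ y)) → T (t₀ ≤ᵇ y)
  from y∈ with Equivalence.to T-∨ y∈
  ... | inj₁ y∈I  = ≤⇒≤ᵇ (proj₁ (∈[[⇒ t₀ t₁ y y∈I))
  ... | inj₂ t₁≤y = ≤⇒≤ᵇ (≤-trans t₀≤t₁ (≤ᵇ⇒≤ t₁ y t₁≤y))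

below-disjoint : ∀ x₀ x₁ y → T (y <ᵇ x₀) → T (y ∈[ x₀ , x₁ [) → ⊥
below-disjoint x₀ x₁ y y<x₀ y∈ = <⇒≱ (<ᵇ⇒< y x₀ y<x₀) (proj₁ (∈[[⇒ x₀ x₁ y y∈))

above-disjoint : ∀ t₀ t₁ y → T (y ∈[ t₀ , t₁ [) → T (t₁ ≤ᵇ y) → ⊥
above-disjoint t₀ t₁ y y∈ t₁≤y = <⇒≱ (proj₂ (∈[[⇒ t₀ t₁ y y∈)) (≤ᵇ⇒≤ t₁ y t₁≤y)

count : ∀ {n} → (Fin n → Bool) → ℕ
count P = sum (𝟙 ∘ P)

∑-mono-≤ : ∀ {n} {F G : Fin n → ℕ} → (∀ i → F i ≤ G i) → sum F ≤ sum G
∑-mono-≤ {zero}  _   = z≤n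
∑-mono-≤ {suc n} F≤G = +-mono-≤ (F≤G fzero) (∑-mono-≤ (F≤G ∘ fsuc))

∑-zero : ∀ {n} {F : Fin n → ℕ} → (∀ i → F i ≡ 0) → sum F ≡ 0
∑-zero {zero}  _    = refl
∑-zero {suc n} F≡0 = cong₂ _+_ (F≡0 fzero) (∑-zero (F≡0 ∘ fsuc))

term≤∑ : ∀ {n} (F : Fin n → ℕ) i → F i ≤ sum F
term≤∑ F fzero    = m≤m+n _ _
term≤∑ F (fsuc i) = ≤-trans (term≤∑ (F ∘ fsuc) i) (m≤n+m _ _)

zeroAt : ∀ {n} → (Fin n → ℕ) → Fin n → Fin n → ℕ
zeroAt F j i = if does (i Finₚ.≟ j) then 0 else F i

zeroAt-≢ : ∀ {n} (F : Fin n → ℕ) {i j} → i ≢ j → zeroAt F j i ≡ F i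
zeroAt-≢ F {i} {j} i≢j rewrite dec-false (i Finₚ.≟ j) i≢j = refl

∑-zeroAt : ∀ {n} (F : Fin n → ℕ) j → sum F ≡ sum (zeroAt F j) + F j
∑-zeroAt F fzero    = +-comm (F fzero) _
∑-zeroAt F (fsuc j) = trans (cong (F fzero +_) (∑-zeroAt (F ∘ fsuc) j)) (sym (+-assoc (F fzero) _ _))

module _ {n : ℕ} {P Q : Fin n → Bool} where

  count-cong : (∀ i → P i ≡ Q i) → count P ≡ count Q
  count-cong P≗Q = sum-cong-≗ (cong 𝟙 ∘ P≗Q)

  count-mono : (∀ i → T (P i) → T (Q i)) → count P ≤ count Q
  count-mono P⇒Q = ∑-mono-≤ (λ i → 𝟙-mono (P⇒Q i))

  count-∨ : (∀ i → T (P i) → T (Q i) → ⊥) → count (λ i → P i ∨ Q i) ≡ count P + count Q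
  count-∨ disjoint = trans (sum-cong-≗ (λ i → 𝟙-∨ (P i) (Q i) (disjoint i))) (∑-distrib-+ (𝟙 ∘ P) (𝟙 ∘ Q))

module _ {n : ℕ} (P : Fin n → Bool) where

  count≡0 : (∀ i → ¬ T (P i)) → count P ≡ 0
  count≡0 none = ∑-zero (𝟙-¬T ∘ none)

  witness⇒count≥1 : ∀ {i} → T (P i) → 1 ≤ count P
  witness⇒count≥1 {i} Pi = subst (_≤ count P) (𝟙-T Pi) (term≤∑ (𝟙 ∘ P) i)

  count≥1⇒witness : 1 ≤ count P → ∃ λ i → T (P i)
  count≥1⇒witness 1≤count = go P 1≤count
    where
    go : ∀ {n} (P : Fin n → Bool) → 1 ≤ count P → ∃ λ i → T (P i)
    go {suc n} P 1≤count with P fzero in eq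
    ... | true  = fzero , subst T (sym eq) _
    ... | false = let (i , Pi) = go (P ∘ fsuc) 1≤count in fsuc i , Pi

  count≤1⇒unique : count P ≤ 1 → ∀ {i j} → T (P i) → T (P j) → i ≡ j
  count≤1⇒unique count≤1 {i} {j} Pi Pj with i Finₚ.≟ j
  ... | yes i≡j = i≡j
  ... | no  i≢j = ⊥-elim (<-irrefl refl (≤-trans 2≤count count≤1))
    where
    2≤count : 2 ≤ count P
    2≤count = begin
      2                                  ≡⟨ cong₂ _+_ (trans (zeroAt-≢ (𝟙 ∘ P) i≢j) (𝟙-T Pi)) (𝟙-T Pj) ⟨
      zeroAt (𝟙 ∘ P) j i + 𝟙 (P j)       ≤⟨ +-monoˡ-≤ (𝟙 (P j)) (term≤∑ (zeroAt (𝟙 ∘ P) j) i) ⟩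
      sum (zeroAt (𝟙 ∘ P) j) + 𝟙 (P j)   ≡⟨ ∑-zeroAt (𝟙 ∘ P) j ⟨
      count P                            ∎
      where open ≤-Reasoning

  unique⇒count≡1 : ∀ {j} → T (P j) → (∀ i → T (P i) → i ≡ j) → count P ≡ 1
  unique⇒count≡1 {j} Pj unique = begin
    count P                            ≡⟨ ∑-zeroAt (𝟙 ∘ P) j ⟩
    sum (zeroAt (𝟙 ∘ P) j) + 𝟙 (P j)   ≡⟨ cong₂ _+_ (∑-zero off-j) (𝟙-T Pj) ⟩
    1                                  ∎
    where
    open ≡-Reasoning
    off-j : ∀ i → zeroAt (𝟙 ∘ P) j i ≡ 0
    off-j i with i Finₚ.≟ j
    ... | yes _ = refl
    ... | no i≢j with P i in eq
    ...   | false = refl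
    ...   | true  = ⊥-elim (i≢j (unique i (subst T (sym eq) _)))

module _ {n : ℕ} {lo hi : Fin n} (lo≢hi : lo ≢ hi) where

  private
    offTwo : (Fin n → ℕ) → Fin n → ℕ
    offTwo F = zeroAt (zeroAt F lo) hi

    ∑-offTwo : ∀ F → sum F ≡ sum (offTwo F) + (F lo + F hi)
    ∑-offTwo F = begin
      sum F
        ≡⟨ ∑-zeroAt F lo ⟩
      sum (zeroAt F lo) + F lo
        ≡⟨ cong (_+ F lo) (∑-zeroAt (zeroAt F lo) hi) ⟩
      sum (offTwo F) + zeroAt F lo hi + F lo
        ≡⟨ cong (λ x → sum (offTwo F) + x + F lo) (zeroAt-≢ F (lo≢hi ∘ sym)) ⟩
      sum (offTwo F) + F hi + F lo
        ≡⟨ +-assoc (sum (offTwo F)) (F hi) (F lo) ⟩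
      sum (offTwo F) + (F hi + F lo)
        ≡⟨ cong (sum (offTwo F) +_) (+-comm (F hi) (F lo)) ⟩
      sum (offTwo F) + (F lo + F hi)
        ∎
      where open ≡-Reasoning

    offTwo-mono : ∀ {F G} → (∀ i → i ≢ lo → i ≢ hi → F i ≤ G i) → sum (offTwo F) ≤ sum (offTwo G)
    offTwo-mono {F} {G} F≤G = ∑-mono-≤ pointwise
      where
      pointwise : ∀ i → offTwo F i ≤ offTwo G i
      pointwise i with i Finₚ.≟ hi
      ... | yes _ = z≤n
      ... | no i≢hi with i Finₚ.≟ lo
      ...   | yes _ = z≤n
      ...   | no i≢lo = F≤G i i≢lo i≢hi

  ∑-exchange-≤ : ∀ {F G} → (∀ i → i ≢ lo → i ≢ hi → F i ≤ G i) →
                 F lo + F hi ≤ G lo + G hi → sum F ≤ sum G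
  ∑-exchange-≤ {F} {G} F≤G ≤atTwo = begin
    sum F                            ≡⟨ ∑-offTwo F ⟩
    sum (offTwo F) + (F lo + F hi)   ≤⟨ +-mono-≤ (offTwo-mono F≤G) ≤atTwo ⟩
    sum (offTwo G) + (G lo + G hi)   ≡⟨ ∑-offTwo G ⟨
    sum G                            ∎
    where open ≤-Reasoning

  ∑-exchange-< : ∀ {F G} → (∀ i → i ≢ lo → i ≢ hi → F i ≤ G i) →
                 F lo + F hi < G lo + G hi → sum F < sum G
  ∑-exchange-< {F} {G} F≤G <atTwo = begin-strict
    sum F                            ≡⟨ ∑-offTwo F ⟩
    sum (offTwo F) + (F lo + F hi)   <⟨ +-mono-≤-< (offTwo-mono F≤G) <atTwo ⟩
    sum (offTwo G) + (G lo + G hi)   ≡⟨ ∑-offTwo G ⟨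
    sum G                            ∎
    where open ≤-Reasoning

  ∑-exchange : ∀ {F G k} → (∀ i → i ≢ lo → i ≢ hi → F i ≡ G i) →
               G lo + G hi ≡ F lo + F hi + k → sum G ≡ sum F + k
  ∑-exchange {F} {G} {k} F≗G atTwo = begin
    sum G                                 ≡⟨ ∑-offTwo G ⟩
    sum (offTwo G) + (G lo + G hi)        ≡⟨ cong₂ _+_ offTwo-≡ atTwo ⟩
    sum (offTwo F) + (F lo + F hi + k)    ≡⟨ +-assoc (sum (offTwo F)) _ k ⟨
    sum (offTwo F) + (F lo + F hi) + k    ≡⟨ cong (_+ k) (∑-offTwo F) ⟨
    sum F + k                             ∎
    where
    open ≡-Reasoning
    offTwo-≡ : sum (offTwo G) ≡ sum (offTwo F)
    offTwo-≡ = ≤-antisym (offTwo-mono (λ i p q → ≤-reflexive (sym (F≗G i p q))))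
                         (offTwo-mono (λ i p q → ≤-reflexive (F≗G i p q)))

transpose-matchˡ : ∀ {n} (i j : Fin n) → transpose i j i ≡ j
transpose-matchˡ i j rewrite dec-true (i Finₚ.≟ i) refl = refl

transpose-matchʳ : ∀ {n} (i j : Fin n) → transpose i j j ≡ i
transpose-matchʳ i j with j Finₚ.≟ i
... | yes j≡i = j≡i
... | no _ rewrite dec-true (j Finₚ.≟ j) refl = refl

transpose-other : ∀ {n} (i j : Fin n) {k} → k ≢ i → k ≢ j → transpose i j k ≡ k
transpose-other i j {k} k≢i k≢j rewrite dec-false (k Finₚ.≟ i) k≢i | dec-false (k Finₚ.≟ j) k≢j = refl

transpose-comm : ∀ {n} (i j k : Fin n) → transpose i j k ≡ transpose j i k
transpose-comm i j k = by-cases (k Finₚ.≟ i) (k Finₚ.≟ j)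
  where
  by-cases : Dec (k ≡ i) → Dec (k ≡ j) → transpose i j k ≡ transpose j i k
  by-cases (yes refl) (yes refl) = refl
  by-cases (yes refl) (no _)     = trans (transpose-matchˡ k j) (sym (transpose-matchʳ j k))
  by-cases (no _)     (yes refl) = trans (transpose-matchʳ i k) (sym (transpose-matchˡ k i))
  by-cases (no k≢i)   (no k≢j)   = trans (transpose-other i j k≢i k≢j) (sym (transpose-other j i k≢j k≢i))

transpose-involutive : ∀ {n} (i j k : Fin n) → transpose i j (transpose i j k) ≡ k
transpose-involutive i j k = trans (cong (transpose i j) (transpose-comm i j k)) (transpose-inverse i j)

transpose-self : ∀ {n} (i k : Fin n) → transpose i i k ≡ k
transpose-self i k = by-cases (k Finₚ.≟ i)
  where
  by-cases : Dec (k ≡ i) → transpose i i k ≡ k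
  by-cases (yes refl) = transpose-matchˡ k k
  by-cases (no k≢i)   = transpose-other i i k≢i k≢i

-- Ranks

rank : ∀ {n} → (Fin n → Fin n) → ℕ → ℕ → ℕ
rank f x t = count (λ i → (toℕ i <ᵇ x) ∧ (t ≤ᵇ toℕ (f i)))

points : ∀ {n} → (Fin n → Fin n) → ℕ → ℕ → ℕ → ℕ → ℕ
points f x₀ x₁ t₀ t₁ = count (λ i → toℕ i ∈[ x₀ , x₁ [ ∧ toℕ (f i) ∈[ t₀ , t₁ [)

rank-cong : ∀ {n} {f g : Fin n → Fin n} → f ≐ g → ∀ x t → rank f x t ≡ rank g x t
rank-cong f≐g x t = count-cong λ i → cong (λ y → (toℕ i <ᵇ x) ∧ (t ≤ᵇ toℕ y)) (f≐g i)

module _ {n : ℕ} (f : Fin n → Fin n) where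

  rank-splitˣ : ∀ {x₀ x₁} t → x₀ ≤ x₁ →
    rank f x₁ t ≡ rank f x₀ t + count (λ i → toℕ i ∈[ x₀ , x₁ [ ∧ (t ≤ᵇ toℕ (f i)))
  rank-splitˣ {x₀} {x₁} t x₀≤x₁ = begin
    rank f x₁ t
      ≡⟨ count-cong (λ i → cong (_∧ above i) (<ᵇ-split x₀≤x₁ (toℕ i))) ⟩
    count (λ i → ((toℕ i <ᵇ x₀) ∨ toℕ i ∈[ x₀ , x₁ [) ∧ above i)
      ≡⟨ count-cong (λ i → ∧-distribʳ-∨ (above i) (toℕ i <ᵇ x₀) (toℕ i ∈[ x₀ , x₁ [)) ⟩
    count (λ i → ((toℕ i <ᵇ x₀) ∧ above i) ∨ (toℕ i ∈[ x₀ , x₁ [ ∧ above i))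
      ≡⟨ count-∨ (λ i → ∧-disjointʳ (above i) (below-disjoint x₀ x₁ (toℕ i))) ⟩
    rank f x₀ t + count (λ i → toℕ i ∈[ x₀ , x₁ [ ∧ above i)
      ∎
    where
    open ≡-Reasoning
    above : Fin n → Bool
    above i = (t ≤ᵇ toℕ (f i))

  above-splitᵗ : ∀ {t₀ t₁} (A : Fin n → Bool) → t₀ ≤ t₁ →
    count (λ i → A i ∧ (t₀ ≤ᵇ toℕ (f i))) ≡
    count (λ i → A i ∧ toℕ (f i) ∈[ t₀ , t₁ [) + count (λ i → A i ∧ (t₁ ≤ᵇ toℕ (f i)))
  above-splitᵗ {t₀} {t₁} A t₀≤t₁ = begin
    count (λ i → A i ∧ (t₀ ≤ᵇ toℕ (f i)))
      ≡⟨ count-cong (λ i → cong (A i ∧_) (≤ᵇ-split t₀≤t₁ (toℕ (f i)))) ⟩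
    count (λ i → A i ∧ (toℕ (f i) ∈[ t₀ , t₁ [ ∨ (t₁ ≤ᵇ toℕ (f i))))
      ≡⟨ count-cong (λ i → ∧-distribˡ-∨ (A i) (toℕ (f i) ∈[ t₀ , t₁ [) (t₁ ≤ᵇ toℕ (f i))) ⟩
    count (λ i → (A i ∧ toℕ (f i) ∈[ t₀ , t₁ [) ∨ (A i ∧ (t₁ ≤ᵇ toℕ (f i))))
      ≡⟨ count-∨ (λ i → ∧-disjointˡ (A i) (above-disjoint t₀ t₁ (toℕ (f i)))) ⟩
    count (λ i → A i ∧ toℕ (f i) ∈[ t₀ , t₁ [) + count (λ i → A i ∧ (t₁ ≤ᵇ toℕ (f i)))
      ∎
    where open ≡-Reasoning

  rank-rectangle : ∀ {x₀ x₁ t₀ t₁} → x₀ ≤ x₁ → t₀ ≤ t₁ →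
    points f x₀ x₁ t₀ t₁ + rank f x₀ t₀ + rank f x₁ t₁ ≡ rank f x₁ t₀ + rank f x₀ t₁
  rank-rectangle {x₀} {x₁} {t₀} {t₁} x₀≤x₁ t₀≤t₁ = begin
    points f x₀ x₁ t₀ t₁ + rank f x₀ t₀ + rank f x₁ t₁
      ≡⟨ cong (points f x₀ x₁ t₀ t₁ + rank f x₀ t₀ +_) (rank-splitˣ t₁ x₀≤x₁) ⟩
    points f x₀ x₁ t₀ t₁ + rank f x₀ t₀ + (rank f x₀ t₁ + strip t₁)
      ≡⟨ rearrange (points f x₀ x₁ t₀ t₁) (rank f x₀ t₀) (rank f x₀ t₁) (strip t₁) ⟩
    rank f x₀ t₀ + (points f x₀ x₁ t₀ t₁ + strip t₁) + rank f x₀ t₁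
      ≡⟨ cong (λ s → rank f x₀ t₀ + s + rank f x₀ t₁) (above-splitᵗ (λ i → toℕ i ∈[ x₀ , x₁ [) t₀≤t₁) ⟨
    rank f x₀ t₀ + strip t₀ + rank f x₀ t₁
      ≡⟨ cong (_+ rank f x₀ t₁) (rank-splitˣ t₀ x₀≤x₁) ⟨
    rank f x₁ t₀ + rank f x₀ t₁
      ∎
    where
    open ≡-Reasoning
    strip : ℕ → ℕ
    strip t = count (λ i → toℕ i ∈[ x₀ , x₁ [ ∧ (t ≤ᵇ toℕ (f i)))
    rearrange : ∀ p r₀ r₁ s → p + r₀ + (r₁ + s) ≡ r₀ + (p + s) + r₁
    rearrange = solve-∀

rectangle-exchange : ∀ {n} (π π′ : Fin n → Fin n) {x₀ x₁ t₀ t₁} → x₀ ≤ x₁ → t₀ ≤ t₁ →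
  rank π x₀ t₀ ≡ rank π′ x₀ t₀ → rank π x₁ t₁ ≡ rank π′ x₁ t₁ → rank π x₀ t₁ ≡ rank π′ x₀ t₁ →
  points π x₀ x₁ t₀ t₁ + rank π′ x₁ t₀ ≡ points π′ x₀ x₁ t₀ t₁ + rank π x₁ t₀
rectangle-exchange π π′ {x₀} {x₁} {t₀} {t₁} x₀≤x₁ t₀≤t₁ same₀₀ same₁₁ same₀₁ =
  +-cancelʳ-≡ (R₀₀ + R₁₁) _ _ (begin
    P + R′₁₀ + (R₀₀ + R₁₁)        ≡⟨ shuffle P R′₁₀ R₀₀ R₁₁ ⟩
    P + R₀₀ + R₁₁ + R′₁₀          ≡⟨ cong (_+ R′₁₀) (rank-rectangle π x₀≤x₁ t₀≤t₁) ⟩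
    R₁₀ + R₀₁ + R′₁₀              ≡⟨ swap R₁₀ R₀₁ R′₁₀ ⟩
    R′₁₀ + R₀₁ + R₁₀              ≡⟨ cong (λ r → R′₁₀ + r + R₁₀) same₀₁ ⟩
    R′₁₀ + rank π′ x₀ t₁ + R₁₀    ≡⟨ cong (_+ R₁₀) (rank-rectangle π′ x₀≤x₁ t₀≤t₁) ⟨
    P′ + rank π′ x₀ t₀ + rank π′ x₁ t₁ + R₁₀
                                  ≡⟨ cong₂ (λ r s → P′ + r + s + R₁₀) same₀₀ same₁₁ ⟨
    P′ + R₀₀ + R₁₁ + R₁₀          ≡⟨ shuffle P′ R₁₀ R₀₀ R₁₁ ⟨
    P′ + R₁₀ + (R₀₀ + R₁₁)        ∎)
  where
  open ≡-Reasoning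
  P = points π x₀ x₁ t₀ t₁
  P′ = points π′ x₀ x₁ t₀ t₁
  R₀₀ = rank π x₀ t₀
  R₁₁ = rank π x₁ t₁
  R₁₀ = rank π x₁ t₀
  R₀₁ = rank π x₀ t₁
  R′₁₀ = rank π′ x₁ t₀
  shuffle : ∀ p r s u → p + r + (s + u) ≡ p + s + u + r
  shuffle = solve-∀
  swap : ∀ p q r → p + q + r ≡ r + q + p
  swap = solve-∀

InBox : ∀ {n} → (Fin n → Fin n) → Fin n → Fin n → ℕ → ℕ → Set
InBox f lo hi x t = toℕ lo < x × x ≤ toℕ hi × toℕ (f lo) < t × t ≤ toℕ (f hi)

module _ {n : ℕ} (f : Fin n → Fin n) {lo hi : Fin n}
         (lo<hi : toℕ lo < toℕ hi) (f-lo<hi : toℕ (f lo) < toℕ (f hi)) where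

  private
    lo≢hi : lo ≢ hi
    lo≢hi refl = <-irrefl refl lo<hi

    unmoved : ∀ {i} → i ≢ lo → i ≢ hi → f (transpose lo hi i) ≡ f i
    unmoved i≢lo i≢hi = cong f (transpose-other lo hi i≢lo i≢hi)

    box : ℕ → ℕ → Bool
    box x t = ((toℕ lo <ᵇ x) ∧ not (toℕ hi <ᵇ x)) ∧ ((t ≤ᵇ toℕ (f hi)) ∧ not (t ≤ᵇ toℕ (f lo)))

    InBox⇒box : ∀ {x t} → InBox f lo hi x t → T (box x t)
    InBox⇒box {x} {t} (lo<x , x≤hi , f-lo<t , t≤f-hi) = T-∧⁺
      (T-∧⁺ (<⇒<ᵇ lo<x) (T-not (λ hi<x → <⇒≱ (<ᵇ⇒< (toℕ hi) x hi<x) x≤hi)))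
      (T-∧⁺ (≤⇒≤ᵇ t≤f-hi) (T-not (λ t≤f-lo → <⇒≱ f-lo<t (≤ᵇ⇒≤ t (toℕ (f lo)) t≤f-lo))))

    box⇒InBox : ∀ {x t} → T (box x t) → InBox f lo hi x t
    box⇒InBox {x} {t} inBox =
      let (cols , rows) = T-∧⁻ inBox
          (lo<x , x≯hi) = T-∧⁻ cols
          (t≤f-hi , t≰f-lo) = T-∧⁻ rows
      in <ᵇ⇒< (toℕ lo) x lo<x , ≮⇒≥ (not-T x≯hi ∘ <⇒<ᵇ)
       , ≰⇒> (not-T t≰f-lo ∘ ≤⇒≤ᵇ) , ≤ᵇ⇒≤ t (toℕ (f hi)) t≤f-hi

  rank-transpose : ∀ x t → rank (f ∘ transpose lo hi) x t ≡ rank f x t + 𝟙 (box x t)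
  rank-transpose x t = ∑-exchange lo≢hi off-two at-two
    where
    a = toℕ lo <ᵇ x
    b = toℕ hi <ᵇ x
    u = t ≤ᵇ toℕ (f lo)
    v = t ≤ᵇ toℕ (f hi)
    counted : (Fin n → Fin n) → Fin n → ℕ
    counted g i = 𝟙 ((toℕ i <ᵇ x) ∧ (t ≤ᵇ toℕ (g i)))
    off-two : ∀ i → i ≢ lo → i ≢ hi → counted f i ≡ counted (f ∘ transpose lo hi) i
    off-two i i≢lo i≢hi = cong (λ y → 𝟙 ((toℕ i <ᵇ x) ∧ (t ≤ᵇ toℕ y))) (sym (unmoved i≢lo i≢hi))
    at-two : 𝟙 (a ∧ (t ≤ᵇ toℕ (f (transpose lo hi lo)))) + 𝟙 (b ∧ (t ≤ᵇ toℕ (f (transpose lo hi hi))))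
           ≡ 𝟙 (a ∧ u) + 𝟙 (b ∧ v) + 𝟙 (box x t)
    at-two rewrite transpose-matchˡ lo hi | transpose-matchʳ lo hi =
      𝟙-rearrange a b u v (λ hi<x → <⇒<ᵇ (<-trans lo<hi (<ᵇ⇒< (toℕ hi) x hi<x)))
                          (λ t≤f-lo → ≤⇒≤ᵇ (≤-trans (≤ᵇ⇒≤ t (toℕ (f lo)) t≤f-lo) (<⇒≤ f-lo<hi)))

  rank-transpose-≤ : ∀ x t → rank f x t ≤ rank (f ∘ transpose lo hi) x t
  rank-transpose-≤ x t = ≤-trans (m≤m+n _ _) (≤-reflexive (sym (rank-transpose x t)))

  rank-transpose-outside : ∀ {x t} → ¬ InBox f lo hi x t → rank (f ∘ transpose lo hi) x t ≡ rank f x t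
  rank-transpose-outside {x} {t} outside = begin
    rank (f ∘ transpose lo hi) x t   ≡⟨ rank-transpose x t ⟩
    rank f x t + 𝟙 (box x t)         ≡⟨ cong (rank f x t +_) (𝟙-¬T (outside ∘ box⇒InBox)) ⟩
    rank f x t + 0                   ≡⟨ +-identityʳ _ ⟩
    rank f x t                       ∎
    where open ≡-Reasoning

  rank-transpose-inside : ∀ {x t} → InBox f lo hi x t → rank (f ∘ transpose lo hi) x t ≡ suc (rank f x t)
  rank-transpose-inside {x} {t} inside = begin
    rank (f ∘ transpose lo hi) x t   ≡⟨ rank-transpose x t ⟩
    rank f x t + 𝟙 (box x t)         ≡⟨ cong (rank f x t +_) (𝟙-T (InBox⇒box inside)) ⟩
    rank f x t + 1                   ≡⟨ +-comm _ 1 ⟩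
    suc (rank f x t)                 ∎
    where open ≡-Reasoning

-- Inversions and the Bruhat order

lowerRight : ∀ {n} → (Fin n → Fin n) → Fin n → ℕ → ℕ
lowerRight f i w = count (λ j → (toℕ i <ᵇ toℕ j) ∧ (toℕ (f j) <ᵇ w))

inversions : ∀ {n} → (Fin n → Fin n) → ℕ
inversions f = sum (λ i → lowerRight f i (toℕ (f i)))

inv≡inversions : ∀ {n} (f : Fin n → Fin n) → inv f ≡ inversions f
inv≡inversions {n} f = trans (listSum-tabulate (λ i → length (filter (inverted i) (tabulate id))) id)
                              (sum-cong-≗ λ i → length-filter-tabulate (inverted i) id)
  where
  inverted : ∀ i j → Dec (toℕ i < toℕ j × toℕ (f j) < toℕ (f i))
  inverted i j = i Finₚ.<? j ×-dec f j Finₚ.<? f i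
  listSum-tabulate : ∀ {m} {A : Set} (G : A → ℕ) (h : Fin m → A) → ListSum.sum (map G (tabulate h)) ≡ sum (G ∘ h)
  listSum-tabulate {zero}  G h = refl
  listSum-tabulate {suc m} G h = cong (G (h fzero) +_) (listSum-tabulate G (h ∘ fsuc))
  length-filter-tabulate : ∀ {m} {A : Set} {P : A → Set} (P? : Decidable P) (h : Fin m → A) →
                           length (filter P? (tabulate h)) ≡ count (does ∘ P? ∘ h)
  length-filter-tabulate {zero}  P? h = refl
  length-filter-tabulate {suc m} P? h with does (P? (h fzero))
  ... | true  = cong suc (length-filter-tabulate P? (h ∘ fsuc))
  ... | false = length-filter-tabulate P? (h ∘ fsuc)

inversions-cong : ∀ {n} {f g : Fin n → Fin n} → f ≐ g → inversions f ≡ inversions g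
inversions-cong {f = f} {g} f≐g = sum-cong-≗ λ i → count-cong λ j →
  cong₂ (λ y z → (toℕ i <ᵇ toℕ j) ∧ (toℕ y <ᵇ toℕ z)) (f≐g j) (f≐g i)

module _ {n : ℕ} (f : Fin n → Fin n) where

  lowerRight-split : ∀ i {w w′} → w ≤ w′ →
    lowerRight f i w′ ≡ lowerRight f i w + count (λ j → (toℕ i <ᵇ toℕ j) ∧ toℕ (f j) ∈[ w , w′ [)
  lowerRight-split i {w} {w′} w≤w′ = begin
    lowerRight f i w′
      ≡⟨ count-cong (λ j → cong (right j ∧_) (<ᵇ-split w≤w′ (toℕ (f j)))) ⟩
    count (λ j → right j ∧ ((toℕ (f j) <ᵇ w) ∨ toℕ (f j) ∈[ w , w′ [))
      ≡⟨ count-cong (λ j → ∧-distribˡ-∨ (right j) (toℕ (f j) <ᵇ w) (toℕ (f j) ∈[ w , w′ [)) ⟩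
    count (λ j → (right j ∧ (toℕ (f j) <ᵇ w)) ∨ (right j ∧ toℕ (f j) ∈[ w , w′ [))
      ≡⟨ count-∨ (λ j → ∧-disjointˡ (right j) (below-disjoint w w′ (toℕ (f j)))) ⟩
    lowerRight f i w + count (λ j → right j ∧ toℕ (f j) ∈[ w , w′ [)
      ∎
    where
    open ≡-Reasoning
    right : Fin n → Bool
    right j = toℕ i <ᵇ toℕ j

module _ {n : ℕ} (f : Fin n → Fin n) {lo hi : Fin n}
         (lo<hi : toℕ lo < toℕ hi) (f-lo<hi : toℕ (f lo) < toℕ (f hi)) where

  private
    g = f ∘ transpose lo hi

    lo≢hi : lo ≢ hi
    lo≢hi refl = <-irrefl refl lo<hi

    unmoved : ∀ {j} → j ≢ lo → j ≢ hi → g j ≡ f j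
    unmoved j≢lo j≢hi = cong f (transpose-other lo hi j≢lo j≢hi)

  lowerRight-transpose-≤ : ∀ i w → lowerRight f i w ≤ lowerRight g i w
  lowerRight-transpose-≤ i w = ∑-exchange-≤ lo≢hi off-two at-two
    where
    counted : (Fin n → Fin n) → Fin n → ℕ
    counted h j = 𝟙 ((toℕ i <ᵇ toℕ j) ∧ (toℕ (h j) <ᵇ w))
    off-two : ∀ j → j ≢ lo → j ≢ hi → counted f j ≤ counted g j
    off-two j j≢lo j≢hi = ≤-reflexive (cong (λ y → 𝟙 ((toℕ i <ᵇ toℕ j) ∧ (toℕ y <ᵇ w))) (sym (unmoved j≢lo j≢hi)))
    at-two : counted f lo + counted f hi ≤ counted g lo + counted g hi
    at-two rewrite transpose-matchˡ lo hi | transpose-matchʳ lo hi =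
      𝟙-rearrange-≤ (λ i<lo → <⇒<ᵇ (<-trans (<ᵇ⇒< (toℕ i) (toℕ lo) i<lo) lo<hi))
                    (λ f-hi<w → <⇒<ᵇ (<-trans f-lo<hi (<ᵇ⇒< (toℕ (f hi)) w f-hi<w)))

  lowerRight-transpose-hi : ∀ w → lowerRight g hi w ≡ lowerRight f hi w
  lowerRight-transpose-hi w = count-cong same
    where
    same : ∀ j → (toℕ hi <ᵇ toℕ j) ∧ (toℕ (g j) <ᵇ w) ≡ (toℕ hi <ᵇ toℕ j) ∧ (toℕ (f j) <ᵇ w)
    same j = ∧-cong-if (toℕ hi <ᵇ toℕ j) λ hi<j →
      let hi<j = <ᵇ⇒< (toℕ hi) (toℕ j) hi<j
      in cong (λ y → toℕ y <ᵇ w) (unmoved (λ { refl → <-asym lo<hi hi<j }) (λ { refl → <-irrefl refl hi<j }))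

  lowerRight-transpose-lo : lowerRight g lo (toℕ (f hi)) ≡ lowerRight f lo (toℕ (f hi)) + 1
  lowerRight-transpose-lo = ∑-exchange lo≢hi off-two at-two
    where
    counted : (Fin n → Fin n) → Fin n → ℕ
    counted h j = 𝟙 ((toℕ lo <ᵇ toℕ j) ∧ (toℕ (h j) <ᵇ toℕ (f hi)))
    off-two : ∀ j → j ≢ lo → j ≢ hi → counted f j ≡ counted g j
    off-two j j≢lo j≢hi = cong (λ y → 𝟙 ((toℕ lo <ᵇ toℕ j) ∧ (toℕ y <ᵇ toℕ (f hi)))) (sym (unmoved j≢lo j≢hi))
    at-two : counted g lo + counted g hi ≡ counted f lo + counted f hi + 1
    at-two rewrite transpose-matchʳ lo hi = trans
      (cong₂ _+_ (𝟙-¬T (<ᵇ-irrefl (toℕ lo) ∘ proj₁ ∘ T-∧⁻)) (𝟙-T (T-∧⁺ (<⇒<ᵇ lo<hi) (<⇒<ᵇ f-lo<hi))))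
      (sym (cong₂ (λ p q → p + q + 1) (𝟙-¬T (<ᵇ-irrefl (toℕ lo) ∘ proj₁ ∘ T-∧⁻))
                                      (𝟙-¬T (<ᵇ-irrefl (toℕ (f hi)) ∘ proj₂ ∘ T-∧⁻))))

  -- Every term of the sum weakly grows; the terms at lo and hi together grow strictly.
  inversions-transpose : inversions f < inversions g
  inversions-transpose = ∑-exchange-< lo≢hi off-two at-two
    where
    R = lowerRight f
    R′ = lowerRight g
    F G : Fin n → ℕ
    F i = R i (toℕ (f i))
    G i = R′ i (toℕ (g i))
    off-two : ∀ i → i ≢ lo → i ≢ hi → F i ≤ G i
    off-two i i≢lo i≢hi = subst (λ y → R i (toℕ (f i)) ≤ R′ i (toℕ y)) (sym (unmoved i≢lo i≢hi))
                                (lowerRight-transpose-≤ i (toℕ (f i)))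
    f-lo≤hi = <⇒≤ f-lo<hi
    between : Fin n → Fin n → Bool
    between i j = (toℕ i <ᵇ toℕ j) ∧ toℕ (f j) ∈[ toℕ (f lo) , toℕ (f hi) [
    strip : Fin n → ℕ
    strip i = count (between i)
    strip-hi≤lo : strip hi ≤ strip lo
    strip-hi≤lo = count-mono {P = between hi} {Q = between lo} λ j hi<j∧ →
      let (hi<j , f-j∈) = T-∧⁻ hi<j∧
      in T-∧⁺ (<⇒<ᵇ (<-trans lo<hi (<ᵇ⇒< (toℕ hi) (toℕ j) hi<j))) f-j∈
    at-two : F lo + F hi < G lo + G hi
    at-two = begin-strict
      R lo (toℕ (f lo)) + R hi (toℕ (f hi))
        ≡⟨ cong (R lo (toℕ (f lo)) +_) (lowerRight-split f hi f-lo≤hi) ⟩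
      R lo (toℕ (f lo)) + (R hi (toℕ (f lo)) + strip hi)
        ≤⟨ +-monoʳ-≤ (R lo (toℕ (f lo))) (+-monoʳ-≤ (R hi (toℕ (f lo))) strip-hi≤lo) ⟩
      R lo (toℕ (f lo)) + (R hi (toℕ (f lo)) + strip lo)
        ≡⟨ swap-middle (R lo (toℕ (f lo))) (R hi (toℕ (f lo))) (strip lo) ⟩
      (R lo (toℕ (f lo)) + strip lo) + R hi (toℕ (f lo))
        ≡⟨ cong (_+ R hi (toℕ (f lo))) (lowerRight-split f lo f-lo≤hi) ⟨
      R lo (toℕ (f hi)) + R hi (toℕ (f lo))
        <⟨ +-monoˡ-< (R hi (toℕ (f lo))) (n<1+n _) ⟩
      suc (R lo (toℕ (f hi))) + R hi (toℕ (f lo))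
        ≡⟨ cong₂ _+_ (trans (+-comm 1 _) (sym lowerRight-transpose-lo))
                     (sym (lowerRight-transpose-hi (toℕ (f lo)))) ⟩
      R′ lo (toℕ (f hi)) + R′ hi (toℕ (f lo))
        ≡⟨ cong₂ (λ y z → R′ lo (toℕ (f y)) + R′ hi (toℕ (f z)))
                 (transpose-matchˡ lo hi) (transpose-matchʳ lo hi) ⟨
      G lo + G hi
        ∎
      where
      open ≤-Reasoning
      swap-middle : ∀ a b c → a + (b + c) ≡ a + c + b
      swap-middle = solve-∀

inv-transpose-ascent : ∀ {n} (f : Fin n → Fin n) {lo hi} → toℕ lo < toℕ hi → toℕ (f lo) < toℕ (f hi) →
                       inv f < inv (f ∘ transpose lo hi)
inv-transpose-ascent f {lo} {hi} lo<hi f-lo<hi =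
  subst₂ _<_ (sym (inv≡inversions f)) (sym (inv≡inversions (f ∘ transpose lo hi)))
             (inversions-transpose f lo<hi f-lo<hi)

inv-cong : ∀ {n} {f g : Fin n → Fin n} → f ≐ g → inv f ≡ inv g
inv-cong {f = f} {g} f≐g = trans (inv≡inversions f) (trans (inversions-cong f≐g) (sym (inv≡inversions g)))

rank-≤-transpose-ordered : ∀ {n} (f : Fin n → Fin n) {lo hi} → toℕ lo < toℕ hi →
                           inv f < inv (f ∘ transpose lo hi) → ∀ x t → rank f x t ≤ rank (f ∘ transpose lo hi) x t
rank-≤-transpose-ordered f {lo} {hi} lo<hi longer x t with <-cmp (toℕ (f lo)) (toℕ (f hi))
... | tri< f-lo<hi _ _ = rank-transpose-≤ f lo<hi f-lo<hi x t
... | tri≈ _ f-lo≡hi _ = ≤-reflexive (rank-cong (λ k → sym (f∘transpose≗f k)) x t)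
  where
  f∘transpose≗f : ∀ k → f (transpose lo hi k) ≡ f k
  f∘transpose≗f k = by-cases (k Finₚ.≟ lo) (k Finₚ.≟ hi)
    where
    by-cases : Dec (k ≡ lo) → Dec (k ≡ hi) → f (transpose lo hi k) ≡ f k
    by-cases (yes refl) _          = trans (cong f (transpose-matchˡ lo hi)) (Finₚ.toℕ-injective (sym f-lo≡hi))
    by-cases (no _)     (yes refl) = trans (cong f (transpose-matchʳ lo hi)) (Finₚ.toℕ-injective f-lo≡hi)
    by-cases (no k≢lo)  (no k≢hi)  = cong f (transpose-other lo hi k≢lo k≢hi)
... | tri> _ _ f-hi<lo = ⊥-elim (<-asym longer (begin-strict
    inv (f ∘ transpose lo hi)
      <⟨ inv-transpose-ascent (f ∘ transpose lo hi) lo<hi swapped ⟩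
    inv (f ∘ transpose lo hi ∘ transpose lo hi)
      ≡⟨ inv-cong (λ k → cong f (transpose-involutive lo hi k)) ⟩
    inv f
      ∎))
  where
  open ≤-Reasoning
  swapped : toℕ (f (transpose lo hi lo)) < toℕ (f (transpose lo hi hi))
  swapped rewrite transpose-matchˡ lo hi | transpose-matchʳ lo hi = f-hi<lo

rank-≤-transpose : ∀ {n} (f : Fin n → Fin n) i j → inv f < inv (f ∘ transpose i j) →
                   ∀ x t → rank f x t ≤ rank (f ∘ transpose i j) x t
rank-≤-transpose f i j longer x t with <-cmp (toℕ i) (toℕ j)
... | tri< i<j _ _ = rank-≤-transpose-ordered f i<j longer x t
... | tri≈ _ i≡j _ = ≤-reflexive (rank-cong (λ k → cong f (sym (identity k))) x t)
  where
  identity : ∀ k → transpose i j k ≡ k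
  identity k rewrite Finₚ.toℕ-injective i≡j = transpose-self j k
... | tri> _ _ j<i = subst (rank f x t ≤_) (rank-cong (sym ∘ comm) x t)
                           (rank-≤-transpose-ordered f j<i (subst (inv f <_) (inv-cong comm) longer) x t)
  where
  comm : ∀ k → f (transpose i j k) ≡ f (transpose j i k)
  comm k = cong f (transpose-comm i j k)

≤B⇒rank≤ : ∀ {n} {f g : Fin n → Fin n} → f ≤B g → ∀ x t → rank f x t ≤ rank g x t
≤B⇒rank≤ (done f≐g) x t = ≤-reflexive (rank-cong f≐g x t)
≤B⇒rank≤ {f = f} (step i j longer rest) x t = ≤-trans (rank-≤-transpose f i j longer x t) (≤B⇒rank≤ rest x t)

≤B-respʳ-≐ : ∀ {n} {f g h : Fin n → Fin n} → f ≤B g → g ≐ h → f ≤B h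
≤B-respʳ-≐ (done f≐g)          g≐h = done (λ i → trans (f≐g i) (g≐h i))
≤B-respʳ-≐ (step i j longer f≤g) g≐h = step i j longer (≤B-respʳ-≐ f≤g g≐h)

-- Dyadic blocks

2^-+ : ∀ k₁ k₂ {m} → k₁ + k₂ ≡ m → 2 ^ k₁ * 2 ^ k₂ ≡ 2 ^ m
2^-+ k₁ k₂ refl = sym (^-distribˡ-+-* 2 k₁ k₂)

∸-complementˡ : ∀ k₁ k₂ {m} → k₁ + k₂ ≡ m → m ∸ k₁ ≡ k₂
∸-complementˡ k₁ k₂ refl = m+n∸m≡n k₁ k₂

∸-complementʳ : ∀ k₁ k₂ {m} → k₁ + k₂ ≡ m → m ∸ k₂ ≡ k₁
∸-complementʳ k₁ k₂ refl = m+n∸n≡m k₁ k₂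

*-2^suc : ∀ c a → c * 2 ^ suc a ≡ 2 * c * 2 ^ a
*-2^suc c a = lemma c (2 ^ a)
  where
  lemma : ∀ c P → c * (2 * P) ≡ 2 * c * P
  lemma = solve-∀

suc-*-2^suc : ∀ c a → suc c * 2 ^ suc a ≡ suc (suc (2 * c)) * 2 ^ a
suc-*-2^suc c a = lemma c (2 ^ a)
  where
  lemma : ∀ c P → suc c * (2 * P) ≡ suc (suc (2 * c)) * P
  lemma = solve-∀

module _ {n : ℕ} where

  InI-index-unique : ∀ {k c c′} (x : Fin n) → InI k c x → InI k c′ x → c ≡ c′
  InI-index-unique {k} {c} {c′} x (c≤x , x<c+1) (c′≤x , x<c′+1) =
    ≤-antisym (≤-pred (*-cancelʳ-< (2 ^ k) c (suc c′) (≤-<-trans c≤x x<c′+1)))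
              (≤-pred (*-cancelʳ-< (2 ^ k) c′ (suc c) (≤-<-trans c′≤x x<c+1)))

  InI-index : ∀ k (x : Fin n) → ∃ λ c → InI k c x
  InI-index k x = toℕ x / 2 ^ k , m/n*n≤m (toℕ x) (2 ^ k) , x<
    where
    instance _ = m^n≢0 2 k
    x< : toℕ x < suc (toℕ x / 2 ^ k) * 2 ^ k
    x< = begin-strict
      toℕ x
        ≡⟨ m≡m%n+[m/n]*n (toℕ x) (2 ^ k) ⟩
      toℕ x % 2 ^ k + toℕ x / 2 ^ k * 2 ^ k
        <⟨ +-monoˡ-< (toℕ x / 2 ^ k * 2 ^ k) (m%n<n (toℕ x) (2 ^ k)) ⟩
      suc (toℕ x / 2 ^ k) * 2 ^ k
        ∎
      where open ≤-Reasoning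

  InI-zero : ∀ {c} (x : Fin n) → InI 0 c x → toℕ x ≡ c
  InI-zero {c} x (c≤x , x<c+1) =
    ≤-antisym (≤-pred (subst (toℕ x <_) (*-identityʳ (suc c)) x<c+1)) (subst (_≤ toℕ x) (*-identityʳ c) c≤x)

  InI⇒index< : ∀ {m k c} (x : Fin n) → k ≤ m → toℕ x < 2 ^ m → InI k c x → c < 2 ^ (m ∸ k)
  InI⇒index< {m} {k} {c} x k≤m x<2^m (c≤x , _) = *-cancelʳ-< (2 ^ k) c (2 ^ (m ∸ k)) (begin-strict
    c * 2 ^ k             ≤⟨ c≤x ⟩
    toℕ x                 <⟨ x<2^m ⟩
    2 ^ m                 ≡⟨ 2^-+ (m ∸ k) k (m∸n+n≡m k≤m) ⟨
    2 ^ (m ∸ k) * 2 ^ k   ∎)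
    where open ≤-Reasoning

  module _ {a c : ℕ} (x : Fin n) where

    InI-halves : InI (suc a) c x → InI a (2 * c) x ⊎ InI a (suc (2 * c)) x
    InI-halves (c≤x , x<c+1) with toℕ x <? suc (2 * c) * 2 ^ a
    ... | yes x<mid = inj₁ (subst (_≤ toℕ x) (*-2^suc c a) c≤x , x<mid)
    ... | no  x≮mid = inj₂ (≮⇒≥ x≮mid , subst (toℕ x <_) (suc-*-2^suc c a) x<c+1)

    lowerHalf⇒InI : InI a (2 * c) x → InI (suc a) c x
    lowerHalf⇒InI (2c≤x , x<mid) =
      subst (_≤ toℕ x) (sym (*-2^suc c a)) 2c≤x ,
      <-≤-trans x<mid (subst (suc (2 * c) * 2 ^ a ≤_) (sym (suc-*-2^suc c a)) (*-monoˡ-≤ (2 ^ a) (n≤1+n (suc (2 * c)))))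

    upperHalf⇒InI : InI a (suc (2 * c)) x → InI (suc a) c x
    upperHalf⇒InI (mid≤x , x<2c+2) =
      ≤-trans (subst (_≤ suc (2 * c) * 2 ^ a) (sym (*-2^suc c a)) (*-monoˡ-≤ (2 ^ a) (n≤1+n (2 * c)))) mid≤x ,
      subst (toℕ x <_) (sym (suc-*-2^suc c a)) x<2c+2

  lowerHalf<upperHalf : ∀ {a c} (x y : Fin n) → InI a (2 * c) x → InI a (suc (2 * c)) y → toℕ x < toℕ y
  lowerHalf<upperHalf x y (_ , x<mid) (mid≤y , _) = <-≤-trans x<mid mid≤y

  lowerHalf≢upperHalf : ∀ {a c} (x y : Fin n) → InI a (2 * c) x → InI a (suc (2 * c)) y → x ≢ y
  lowerHalf≢upperHalf {a} {c} x y x∈ y∈ refl = <-irrefl refl (lowerHalf<upperHalf {a} {c} x x x∈ y∈)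

InI-whole : ∀ m (x : Fin (2 ^ m)) → InI m 0 x
InI-whole m x = z≤n , subst (toℕ x <_) (sym (+-identityʳ (2 ^ m))) (Finₚ.toℕ<n x)

multiple-inside-block : ∀ k₁ k c₁ c → k₁ ≤ k → c₁ * 2 ^ k₁ < c * 2 ^ k → c * 2 ^ k < suc c₁ * 2 ^ k₁ → ⊥
multiple-inside-block k₁ k c₁ c k₁≤k below above =
  <-irrefl refl (<-≤-trans (*-cancelʳ-< (2 ^ k₁) e (suc c₁) (subst (_< suc c₁ * 2 ^ k₁) c2^k≡ above))
                           (*-cancelʳ-< (2 ^ k₁) c₁ e (subst (c₁ * 2 ^ k₁ <_) c2^k≡ below)))
  where
  e = c * 2 ^ (k ∸ k₁)
  c2^k≡ : c * 2 ^ k ≡ e * 2 ^ k₁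
  c2^k≡ = trans (cong (c *_) (sym (2^-+ (k ∸ k₁) k₁ (m∸n+n≡m k₁≤k)))) (sym (*-assoc c _ _))

InI-offset : ∀ {n} k c d (x : Fin n) → d < 2 ^ k → toℕ x ≡ d + c * 2 ^ k → InI k c x
InI-offset k c d x d<2^k x≡ =
  subst (c * 2 ^ k ≤_) (sym x≡) (m≤n+m (c * 2 ^ k) d) ,
  subst (_< suc c * 2 ^ k) (sym x≡) (+-monoˡ-< (c * 2 ^ k) d<2^k)

InI-offset⁻ : ∀ {n} k c (x : Fin n) → InI k c x → ∃ λ d → d < 2 ^ k × toℕ x ≡ d + c * 2 ^ k
InI-offset⁻ k c x (c≤x , x<c+1) =
  toℕ x ∸ c * 2 ^ k ,
  +-cancelʳ-< (c * 2 ^ k) _ _ (subst (_< 2 ^ k + c * 2 ^ k) (sym (m∸n+n≡m c≤x)) x<c+1) ,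
  sym (m∸n+n≡m c≤x)

double< : ∀ {c P} → c < P → suc (2 * c) < 2 * P
double< {c} {P} c<P = subst (_≤ 2 * P) (*-suc 2 c) (*-monoʳ-≤ 2 c<P)

halves-disjoint : ∀ {n} b c (x : Fin n) → InI b (2 * c) x → InI b (suc (2 * c)) x → ⊥
halves-disjoint b c x lower upper = lowerHalf≢upperHalf {a = b} {c} x x lower upper refl

module _ {n : ℕ} (a c : ℕ) (x y : Fin n) (x∈ : InI (suc a) c x) (y∈ : InI (suc a) c y) where

  level-between : ∀ e k → toℕ x < e * 2 ^ k → e * 2 ^ k ≤ toℕ y → k ≤ a
  level-between e k x<p p≤y with suc a ≤? k
  ... | yes a<k = ⊥-elim (multiple-inside-block (suc a) k c e a<k
                                (≤-<-trans (proj₁ x∈) x<p) (≤-<-trans p≤y (proj₂ y∈)))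
  ... | no  a≮k = ≤-pred (≰⇒> a≮k)

  odd-between : ∀ c′ → toℕ x < suc (2 * c′) * 2 ^ a → suc (2 * c′) * 2 ^ a ≤ toℕ y → c′ ≡ c
  odd-between c′ x<p p≤y = ≤-antisym
    (*-cancelˡ-≤ 2 (≤-pred (≤-pred (*-cancelʳ-< (2 ^ a) (suc (2 * c′)) (suc (suc (2 * c)))
      (≤-<-trans p≤y (subst (toℕ y <_) (suc-*-2^suc c a) (proj₂ y∈)))))))
    (*-cancelˡ-≤ 2 (≤-pred (*-cancelʳ-< (2 ^ a) (2 * c) (suc (2 * c′))
      (≤-<-trans (subst (_≤ toℕ x) (*-2^suc c a) (proj₁ x∈)) x<p))))

m≤o⇒n≤p⇒m+n≡o+p⇒m≡o : ∀ {m n o p} → m ≤ o → n ≤ p → m + n ≡ o + p → m ≡ o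
m≤o⇒n≤p⇒m+n≡o+p⇒m≡o m≤o n≤p m+n≡o+p with m≤n⇒m<n∨m≡n m≤o
... | inj₂ m≡o = m≡o
... | inj₁ m<o = ⊥-elim (<-irrefl m+n≡o+p (+-mono-<-≤ m<o n≤p))

module _ {n : ℕ} (b c : ℕ) (x y : Fin n) (x∈ : InI (suc b) c x) (y∈ : InI (suc b) c y) where

  common-half-by-lower : (InI b (2 * c) x ⇔ InI b (2 * c) y) → ∃ λ c′ → InI b c′ x × InI b c′ y
  common-half-by-lower x⇔y with InI-halves {a = b} {c} x x∈ | InI-halves {a = b} {c} y y∈
  ... | inj₁ x∈₀ | inj₁ y∈₀ = 2 * c , x∈₀ , y∈₀
  ... | inj₂ x∈₁ | inj₂ y∈₁ = suc (2 * c) , x∈₁ , y∈₁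
  ... | inj₁ x∈₀ | inj₂ y∈₁ = ⊥-elim (halves-disjoint b c y (Equivalence.to x⇔y x∈₀) y∈₁)
  ... | inj₂ x∈₁ | inj₁ y∈₀ = ⊥-elim (halves-disjoint b c x (Equivalence.from x⇔y y∈₀) x∈₁)

  common-half-by-upper : (InI b (suc (2 * c)) x ⇔ InI b (suc (2 * c)) y) → ∃ λ c′ → InI b c′ x × InI b c′ y
  common-half-by-upper x⇔y with InI-halves {a = b} {c} x x∈ | InI-halves {a = b} {c} y y∈
  ... | inj₁ x∈₀ | inj₁ y∈₀ = 2 * c , x∈₀ , y∈₀
  ... | inj₂ x∈₁ | inj₂ y∈₁ = suc (2 * c) , x∈₁ , y∈₁
  ... | inj₁ x∈₀ | inj₂ y∈₁ = ⊥-elim (halves-disjoint b c x x∈₀ (Equivalence.from x⇔y y∈₁))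
  ... | inj₂ x∈₁ | inj₁ y∈₀ = ⊥-elim (halves-disjoint b c y y∈₀ (Equivalence.to x⇔y x∈₁))

InI⇒inI? : ∀ {n} k c (x : Fin n) → InI k c x → T (inI? k c x)
InI⇒inI? k c x (c≤x , x<c+1) = ⇒∈[[ c≤x x<c+1

inI?⇒InI : ∀ {n} k c (x : Fin n) → T (inI? k c x) → InI k c x
inI?⇒InI k c x = ∈[[⇒ (c * 2 ^ k) (suc c * 2 ^ k) (toℕ x)

unitPoint : ∀ {n} → (Fin n → Fin n) → ℕ → ℕ → ℕ → ℕ → Fin n → Bool
unitPoint π k₁ c₁ k₂ c₂ i = inI? k₁ c₁ i ∧ inI? k₂ c₂ (π i)

unitCount : ∀ {n} → (Fin n → Fin n) → ℕ → ℕ → ℕ → ℕ → ℕ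
unitCount π k₁ c₁ k₂ c₂ = count (unitPoint π k₁ c₁ k₂ c₂)

module _ {m : ℕ} {π : Fin (2 ^ m) → Fin (2 ^ m)} where

  private
    index-bound : ∀ k₁ k₂ {c} → k₁ + k₂ ≡ m → c < 2 ^ k₂ → c < 2 ^ (m ∸ k₁)
    index-bound k₁ k₂ {c} k₁+k₂≡m = subst (λ k → c < 2 ^ k) (sym (∸-complementˡ k₁ k₂ k₁+k₂≡m))

    index-bound⁻ : ∀ k₁ k₂ {c} → k₁ + k₂ ≡ m → c < 2 ^ (m ∸ k₁) → c < 2 ^ k₂
    index-bound⁻ k₁ k₂ {c} k₁+k₂≡m = subst (λ k → c < 2 ^ k) (∸-complementˡ k₁ k₂ k₁+k₂≡m)

    dwd-at : DWD m π → ∀ k₁ k₂ {c₁ c₂} → k₁ + k₂ ≡ m → c₁ < 2 ^ k₂ → c₂ < 2 ^ k₁ →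
             ∃! _≡_ (λ i → InI k₁ c₁ i × InI k₂ c₂ (π i))
    dwd-at dwd k₁ k₂ k₁+k₂≡m c₁< c₂< =
      dwd k₁ k₂ k₁+k₂≡m _ _ (index-bound k₁ k₂ k₁+k₂≡m c₁<) (index-bound k₂ k₁ (trans (+-comm k₂ k₁) k₁+k₂≡m) c₂<)

  DWD⇒unitCount≡1 : DWD m π → ∀ k₁ k₂ {c₁ c₂} → k₁ + k₂ ≡ m → c₁ < 2 ^ k₂ → c₂ < 2 ^ k₁ →
                    unitCount π k₁ c₁ k₂ c₂ ≡ 1
  DWD⇒unitCount≡1 dwd k₁ k₂ {c₁} {c₂} k₁+k₂≡m c₁< c₂< =
    let (i , (i∈ , πi∈) , unique) = dwd-at dwd k₁ k₂ k₁+k₂≡m c₁< c₂<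
    in unique⇒count≡1 (unitPoint π k₁ c₁ k₂ c₂) (T-∧⁺ (InI⇒inI? k₁ c₁ i i∈) (InI⇒inI? k₂ c₂ (π i) πi∈))
         λ j j∈∧ → let (j∈ , πj∈) = T-∧⁻ j∈∧
                   in sym (unique (inI?⇒InI k₁ c₁ j j∈ , inI?⇒InI k₂ c₂ (π j) πj∈))

  unitCount≡1⇒DWD : (∀ k₁ k₂ {c₁ c₂} → k₁ + k₂ ≡ m → c₁ < 2 ^ k₂ → c₂ < 2 ^ k₁ →
                     unitCount π k₁ c₁ k₂ c₂ ≡ 1) →
                    DWD m π
  unitCount≡1⇒DWD unit k₁ k₂ k₁+k₂≡m c₁ c₂ c₁< c₂< =
    let (i , i∈∧) = count≥1⇒witness (unitPoint π k₁ c₁ k₂ c₂) (≤-reflexive (sym one))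
        (i∈ , πi∈) = T-∧⁻ i∈∧
    in i , (inI?⇒InI k₁ c₁ i i∈ , inI?⇒InI k₂ c₂ (π i) πi∈) ,
       λ {j} (j∈ , πj∈) → count≤1⇒unique (unitPoint π k₁ c₁ k₂ c₂) (≤-reflexive one) i∈∧
                            (T-∧⁺ (InI⇒inI? k₁ c₁ j j∈) (InI⇒inI? k₂ c₂ (π j) πj∈))
    where
    one : unitCount π k₁ c₁ k₂ c₂ ≡ 1
    one = unit k₁ k₂ k₁+k₂≡m (index-bound⁻ k₁ k₂ k₁+k₂≡m c₁<)
                             (index-bound⁻ k₂ k₁ (trans (+-comm k₂ k₁) k₁+k₂≡m) c₂<)

  module _ (dwd : DWD m π) where

    dwd-exists : ∀ k₁ k₂ {c₁ c₂} → k₁ + k₂ ≡ m → c₁ < 2 ^ k₂ → c₂ < 2 ^ k₁ →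
                 ∃ λ i → InI k₁ c₁ i × InI k₂ c₂ (π i)
    dwd-exists k₁ k₂ k₁+k₂≡m c₁< c₂< =
      let (i , i∈ , _) = dwd-at dwd k₁ k₂ k₁+k₂≡m c₁< c₂<
      in i , i∈

    dwd-unique : ∀ k₁ k₂ c₁ c₂ {i j} → k₁ + k₂ ≡ m →
                 InI k₁ c₁ i → InI k₂ c₂ (π i) → InI k₁ c₁ j → InI k₂ c₂ (π j) → i ≡ j
    dwd-unique k₁ k₂ c₁ c₂ {i} {j} k₁+k₂≡m i∈ πi∈ j∈ πj∈ =
      let k₁≤m = subst (k₁ ≤_) k₁+k₂≡m (m≤m+n k₁ k₂)
          k₂≤m = subst (k₂ ≤_) k₁+k₂≡m (m≤n+m k₂ k₁)
          (_ , _ , unique) = dwd k₁ k₂ k₁+k₂≡m c₁ c₂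
                               (InI⇒index< {k = k₁} {c₁} i k₁≤m (Finₚ.toℕ<n i) i∈)
                               (InI⇒index< {k = k₂} {c₂} (π i) k₂≤m (Finₚ.toℕ<n (π i)) πi∈)
      in trans (sym (unique (i∈ , πi∈))) (unique (j∈ , πj∈))

-- Left of x = c₁ 2^k₁ lie c₁ column blocks, above t = c₂ 2^k₂ lie d row blocks, and in a DWD
-- permutation each pair of them shares exactly one point.
GridRanks : (m : ℕ) → (Fin (2 ^ m) → Fin (2 ^ m)) → Set
GridRanks m π = ∀ k₁ k₂ {c₁} c₂ d → k₁ + k₂ ≡ m → c₁ ≤ 2 ^ k₂ → c₂ + d ≡ 2 ^ k₁ →
                rank π (c₁ * 2 ^ k₁) (c₂ * 2 ^ k₂) ≡ c₁ * d

module _ {m : ℕ} {π : Fin (2 ^ m) → Fin (2 ^ m)} where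

  DWD⇒GridRanks : DWD m π → GridRanks m π
  DWD⇒GridRanks dwd k₁ k₂ {c₁} c₂ d k₁+k₂≡m c₁≤ c₂+d≡ = columns c₁ c₁≤
    where
    column : ∀ {c} c′ d′ → c < 2 ^ k₂ → c′ + d′ ≡ 2 ^ k₁ →
             count (λ i → inI? k₁ c i ∧ (c′ * 2 ^ k₂ ≤ᵇ toℕ (π i))) ≡ d′
    column {c} c′ zero c< c′+0≡ = count≡0 _ λ i i∈∧ →
      <⇒≱ (Finₚ.toℕ<n (π i)) (begin
        2 ^ m             ≡⟨ 2^-+ k₁ k₂ k₁+k₂≡m ⟨
        2 ^ k₁ * 2 ^ k₂   ≡⟨ cong (_* 2 ^ k₂) (trans (sym (+-identityʳ c′)) c′+0≡) ⟨
        c′ * 2 ^ k₂       ≤⟨ ≤ᵇ⇒≤ (c′ * 2 ^ k₂) (toℕ (π i)) (proj₂ (T-∧⁻ i∈∧)) ⟩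
        toℕ (π i)         ∎)
      where open ≤-Reasoning
    column {c} c′ (suc d′) c< c′+d′≡ = begin
      count (λ i → inI? k₁ c i ∧ (c′ * 2 ^ k₂ ≤ᵇ toℕ (π i)))
        ≡⟨ above-splitᵗ π (inI? k₁ c) (*-monoˡ-≤ (2 ^ k₂) (n≤1+n c′)) ⟩
      unitCount π k₁ c k₂ c′ + count (λ i → inI? k₁ c i ∧ (suc c′ * 2 ^ k₂ ≤ᵇ toℕ (π i)))
        ≡⟨ cong₂ _+_ (DWD⇒unitCount≡1 dwd k₁ k₂ k₁+k₂≡m c< (subst (c′ <_) c′+d′≡ (m<m+n c′ (s≤s z≤n))))
                     (column (suc c′) d′ c< (trans (sym (+-suc c′ d′)) c′+d′≡)) ⟩
      suc d′
        ∎
      where open ≡-Reasoning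
    columns : ∀ c → c ≤ 2 ^ k₂ → rank π (c * 2 ^ k₁) (c₂ * 2 ^ k₂) ≡ c * d
    columns zero    _  = count≡0 (λ i → (toℕ i <ᵇ 0) ∧ (c₂ * 2 ^ k₂ ≤ᵇ toℕ (π i))) (λ _ ())
    columns (suc c) c< = begin
      rank π (suc c * 2 ^ k₁) (c₂ * 2 ^ k₂)
        ≡⟨ rank-splitˣ π (c₂ * 2 ^ k₂) (*-monoˡ-≤ (2 ^ k₁) (n≤1+n c)) ⟩
      rank π (c * 2 ^ k₁) (c₂ * 2 ^ k₂) + count (λ i → inI? k₁ c i ∧ (c₂ * 2 ^ k₂ ≤ᵇ toℕ (π i)))
        ≡⟨ cong₂ _+_ (columns c (<⇒≤ c<)) (column c₂ d c< c₂+d≡) ⟩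
      c * d + d
        ≡⟨ +-comm (c * d) d ⟩
      suc c * d
        ∎
      where open ≡-Reasoning

  GridRanks⇒DWD : GridRanks m π → DWD m π
  GridRanks⇒DWD grid = unitCount≡1⇒DWD λ k₁ k₂ {c₁} {c₂} k₁+k₂≡m c₁< c₂< →
    let d = 2 ^ k₁ ∸ suc c₂
        c₂+1+d≡ : suc c₂ + d ≡ 2 ^ k₁
        c₂+1+d≡ = m+[n∸m]≡n c₂<
        R : ℕ → ℕ → ℕ
        R c c′ = rank π (c * 2 ^ k₁) (c′ * 2 ^ k₂)
        at : ∀ {c} c′ d′ → c ≤ 2 ^ k₂ → c′ + d′ ≡ 2 ^ k₁ → R c c′ ≡ c * d′
        at c′ d′ = grid k₁ k₂ c′ d′ k₁+k₂≡m
    in +-cancelʳ-≡ _ _ 1 (begin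
      unitCount π k₁ c₁ k₂ c₂ + (c₁ * suc d + suc c₁ * d)
        ≡⟨ cong₂ (λ a b → unitCount π k₁ c₁ k₂ c₂ + (a + b))
                 (at c₂ (suc d) (<⇒≤ c₁<) (trans (+-suc c₂ d) c₂+1+d≡)) (at (suc c₂) d c₁< c₂+1+d≡) ⟨
      unitCount π k₁ c₁ k₂ c₂ + (R c₁ c₂ + R (suc c₁) (suc c₂))
        ≡⟨ +-assoc (unitCount π k₁ c₁ k₂ c₂) _ _ ⟨
      unitCount π k₁ c₁ k₂ c₂ + R c₁ c₂ + R (suc c₁) (suc c₂)
        ≡⟨ rank-rectangle π (*-monoˡ-≤ (2 ^ k₁) (n≤1+n c₁)) (*-monoˡ-≤ (2 ^ k₂) (n≤1+n c₂)) ⟩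
      R (suc c₁) c₂ + R c₁ (suc c₂)
        ≡⟨ cong₂ _+_ (at c₂ (suc d) c₁< (trans (+-suc c₂ d) c₂+1+d≡))
                     (at (suc c₂) d (<⇒≤ c₁<) c₂+1+d≡) ⟩
      suc c₁ * suc d + c₁ * d
        ≡⟨ rectangle-arithmetic c₁ d ⟩
      1 + (c₁ * suc d + suc c₁ * d)
        ∎)
    where
    open ≡-Reasoning
    rectangle-arithmetic : ∀ c d → suc c * suc d + c * d ≡ 1 + (c * suc d + suc c * d)
    rectangle-arithmetic = solve-∀

GridRanks-agree : ∀ {m} {π π′ : Fin (2 ^ m) → Fin (2 ^ m)} → GridRanks m π → GridRanks m π′ →
  ∀ k₁ k₂ {c₁ c₂} → k₁ + k₂ ≡ m → c₁ ≤ 2 ^ k₂ → c₂ ≤ 2 ^ k₁ →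
  rank π (c₁ * 2 ^ k₁) (c₂ * 2 ^ k₂) ≡ rank π′ (c₁ * 2 ^ k₁) (c₂ * 2 ^ k₂)
GridRanks-agree grid grid′ k₁ k₂ {c₁} {c₂} k₁+k₂≡m c₁≤ c₂≤ =
  trans (grid k₁ k₂ c₂ (2 ^ k₁ ∸ c₂) k₁+k₂≡m c₁≤ (m+[n∸m]≡n c₂≤))
        (sym (grid′ k₁ k₂ c₂ (2 ^ k₁ ∸ c₂) k₁+k₂≡m c₁≤ (m+[n∸m]≡n c₂≤)))

-- Complementary pairs

-- The complementary pair (S, T) with k₁ = suc a, k₂ = suc b, S = InI (suc a) c₁, T = InI (suc b) c₂.
record Pair (m : ℕ) : Set where
  constructor pair
  field
    a b c₁ c₂ : ℕ
    a+1+b≡m   : a + suc b ≡ m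
    c₁<2^b    : c₁ < 2 ^ b
    c₂<2^a    : c₂ < 2 ^ a

  1+a+b≡m : suc a + b ≡ m
  1+a+b≡m = trans (sym (+-suc a b)) a+1+b≡m

fromPair : ∀ {m} → Pair m → CPair m
fromPair {m} D = cpair (suc a) (suc b) (cong suc a+1+b≡m) (s≤s z≤n) (s≤s z≤n)
  c₁ (subst (λ k → c₁ < 2 ^ k) (sym (∸-complementˡ (suc a) b 1+a+b≡m)) c₁<2^b)
  c₂ (subst (λ k → c₂ < 2 ^ k) (sym (∸-complementʳ a (suc b) a+1+b≡m)) c₂<2^a)
  where open Pair D

toPair : ∀ {m} → CPair m → Pair m
toPair (cpair zero    _       _     () _  _ _ _ _)
toPair (cpair (suc a) zero    _     _  () _ _ _ _)
toPair {m} (cpair (suc a) (suc b) 1+a+1+b≡1+m _ _ c₁ c₁< c₂ c₂<) =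
  pair a b c₁ c₂ e
    (subst (λ k → c₁ < 2 ^ k) (∸-complementˡ (suc a) b (trans (sym (+-suc a b)) e)) c₁<)
    (subst (λ k → c₂ < 2 ^ k) (∸-complementʳ a (suc b) e) c₂<)
  where
  e = suc-injective 1+a+1+b≡1+m

Pair-≡ : ∀ {m} {D D′ : Pair m} →
         Pair.a D ≡ Pair.a D′ → Pair.c₁ D ≡ Pair.c₁ D′ → Pair.c₂ D ≡ Pair.c₂ D′ → D ≡ D′
Pair-≡ {D = pair x y c c′ e c< c′<} {pair .x y′ .c .c′ e′ c<′ c′<′} refl refl refl
  with +-cancelˡ-≡ x y y′ (suc-injective (trans (sym (+-suc x y)) (trans e (trans (sym e′) (+-suc x y′)))))
... | refl rewrite ≡-irrelevant e e′ | <-irrelevant c< c<′ | <-irrelevant c′< c′<′ = refl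

toPair-fromPair : ∀ {m} (D : Pair m) → toPair (fromPair D) ≡ D
toPair-fromPair D = Pair-≡ refl refl refl

CPair-≡ : ∀ {m} {p q : CPair m} →
          CPair.k₁ p ≡ CPair.k₁ q → CPair.c₁ p ≡ CPair.c₁ q → CPair.c₂ p ≡ CPair.c₂ q → p ≡ q
CPair-≡ {p = cpair k k′ s l l′ c c< c′ c′<} {cpair .k k″ s′ r r′ .c d< .c′ d′<} refl refl refl
  with +-cancelˡ-≡ k k′ k″ (trans s (sym s′))
... | refl rewrite ≡-irrelevant s s′ | ≤-irrelevant l r | ≤-irrelevant l′ r′
                 | <-irrelevant c< d< | <-irrelevant c′< d′< = refl

fromPair-toPair : ∀ {m} (p : CPair m) → fromPair (toPair p) ≡ p
fromPair-toPair (cpair zero    _       _ () _ _ _ _ _)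
fromPair-toPair (cpair (suc a) zero    _ _ () _ _ _ _)
fromPair-toPair (cpair (suc a) (suc b) _ _ _ _ _ _ _) = CPair-≡ refl refl refl

_≟ᴾ_ : ∀ {m} (D D′ : Pair m) → Dec (D ≡ D′)
D ≟ᴾ D′ with Pair.a D ≟ Pair.a D′ | Pair.c₁ D ≟ Pair.c₁ D′ | Pair.c₂ D ≟ Pair.c₂ D′
... | yes a≡ | yes c₁≡ | yes c₂≡ = yes (Pair-≡ a≡ c₁≡ c₂≡)
... | no a≢  | _       | _       = no (a≢ ∘ cong Pair.a)
... | yes _  | no c₁≢  | _       = no (c₁≢ ∘ cong Pair.c₁)
... | yes _  | yes _   | no c₂≢  = no (c₂≢ ∘ cong Pair.c₂)

Φ : ∀ {m} → (Fin (2 ^ m) → Fin (2 ^ m)) → Pair m → Bool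
Φ {m} π D = φ₀ m π (fromPair D)

module _ {m : ℕ} (π : Fin (2 ^ m) → Fin (2 ^ m)) (D : Pair m) where
  open Pair D

  Inverted : Fin (2 ^ m) → Fin (2 ^ m) → Set
  Inverted x y = toℕ x < toℕ y × InI (suc a) c₁ x × InI (suc a) c₁ y ×
                 InI (suc b) c₂ (π x) × InI (suc b) c₂ (π y) × toℕ (π y) < toℕ (π x)

  Φ⇒inverted : T (Φ π D) → ∃₂ Inverted
  Φ⇒inverted Φ-true =
    let (x , Tx) = satisfied (any⁻ _ (allFin (2 ^ m)) Φ-true)
        (y , Txy) = satisfied (any⁻ _ (allFin (2 ^ m)) Tx)
        (x<y , rest₁) = T-∧⁻ Txy
        (x∈S , rest₂) = T-∧⁻ rest₁
        (y∈S , rest₃) = T-∧⁻ rest₂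
        (πx∈T , rest₄) = T-∧⁻ rest₃
        (πy∈T , πy<πx) = T-∧⁻ rest₄
    in x , y , <ᵇ⇒< (toℕ x) (toℕ y) x<y ,
       inI?⇒InI (suc a) c₁ x x∈S , inI?⇒InI (suc a) c₁ y y∈S ,
       inI?⇒InI (suc b) c₂ (π x) πx∈T , inI?⇒InI (suc b) c₂ (π y) πy∈T ,
       <ᵇ⇒< (toℕ (π y)) (toℕ (π x)) πy<πx

  inverted⇒Φ : ∀ {x y} → Inverted x y → T (Φ π D)
  inverted⇒Φ {x} {y} (x<y , x∈S , y∈S , πx∈T , πy∈T , πy<πx) =
    any⁺ _ (lose (∈-allFin x) (any⁺ _ (lose (∈-allFin y)
      (T-∧⁺ (<⇒<ᵇ x<y) (T-∧⁺ (InI⇒inI? (suc a) c₁ x x∈S) (T-∧⁺ (InI⇒inI? (suc a) c₁ y y∈S)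
        (T-∧⁺ (InI⇒inI? (suc b) c₂ (π x) πx∈T) (T-∧⁺ (InI⇒inI? (suc b) c₂ (π y) πy∈T) (<⇒<ᵇ πy<πx)))))))))

Φ-cong : ∀ {m} {f g : Fin (2 ^ m) → Fin (2 ^ m)} → f ≐ g → ∀ (D : Pair m) → Φ f D ≡ Φ g D
Φ-cong {m} {f} {g} f≐g D = T-ext {Φ f D} {Φ g D} (transport f g f≐g) (transport g f (sym ∘ f≐g))
  where
  transport : ∀ (f g : Fin (2 ^ m) → Fin (2 ^ m)) → f ≐ g → T (Φ f D) → T (Φ g D)
  transport f g f≐g Φ-true =
    let (x , y , x<y , x∈ , y∈ , fx∈ , fy∈ , fy<fx) = Φ⇒inverted f D Φ-true
    in inverted⇒Φ g D ( x<y , x∈ , y∈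
                       , subst (InI (suc b) c₂) (f≐g x) fx∈ , subst (InI (suc b) c₂) (f≐g y) fy∈
                       , subst₂ (λ u v → toℕ u < toℕ v) (f≐g y) (f≐g x) fy<fx )
    where open Pair D

module Corner {m : ℕ} (D : Pair m) where
  open Pair D

  x₀ x₁ t₀ t₁ : ℕ
  x₀ = 2 * c₁ * 2 ^ a
  x₁ = suc (2 * c₁) * 2 ^ a
  t₀ = suc (2 * c₂) * 2 ^ b
  t₁ = suc (suc (2 * c₂)) * 2 ^ b

  lowerToUpper : (Fin (2 ^ m) → Fin (2 ^ m)) → ℕ
  lowerToUpper π = unitCount π a (2 * c₁) b (suc (2 * c₂))

  module _ {π π′ : Fin (2 ^ m) → Fin (2 ^ m)} (grid : GridRanks m π) (grid′ : GridRanks m π′) where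

    private
      agree : ∀ k₁ k₂ {c c′} → k₁ + k₂ ≡ m → c ≤ 2 ^ k₂ → c′ ≤ 2 ^ k₁ →
              rank π (c * 2 ^ k₁) (c′ * 2 ^ k₂) ≡ rank π′ (c * 2 ^ k₁) (c′ * 2 ^ k₂)
      agree = GridRanks-agree grid grid′

      agree-x₀ : ∀ t → rank π (c₁ * 2 ^ suc a) t ≡ rank π′ (c₁ * 2 ^ suc a) t → rank π x₀ t ≡ rank π′ x₀ t
      agree-x₀ t = subst (λ x → rank π x t ≡ rank π′ x t) (*-2^suc c₁ a)

    -- lowerToUpper counts the points in [x₀, x₁) × [t₀, t₁). Of the corners of this rectangle only
    -- (x₁, t₀) is not a grid point, so the rectangle identity ties lowerToUpper π to rank π x₁ t₀.
    lowerToUpper-shift : ∀ {k} → rank π′ x₁ t₀ ≡ rank π x₁ t₀ + k → lowerToUpper π′ ≡ lowerToUpper π + k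
    lowerToUpper-shift {k} shifted = +-cancelʳ-≡ (rank π x₁ t₀) _ _ (begin
      lowerToUpper π′ + rank π x₁ t₀
        ≡⟨ rectangle-exchange π π′ x₀≤x₁ t₀≤t₁ corner₀₀ corner₁₁ corner₀₁ ⟨
      lowerToUpper π + rank π′ x₁ t₀
        ≡⟨ cong (lowerToUpper π +_) shifted ⟩
      lowerToUpper π + (rank π x₁ t₀ + k)
        ≡⟨ shuffle (lowerToUpper π) (rank π x₁ t₀) k ⟩
      lowerToUpper π + k + rank π x₁ t₀
        ∎)
      where
      open ≡-Reasoning
      shuffle : ∀ q r k → q + (r + k) ≡ q + k + r
      shuffle = solve-∀
      x₀≤x₁ : x₀ ≤ x₁
      x₀≤x₁ = *-monoˡ-≤ (2 ^ a) (n≤1+n (2 * c₁))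
      t₀≤t₁ : t₀ ≤ t₁
      t₀≤t₁ = *-monoˡ-≤ (2 ^ b) (n≤1+n (suc (2 * c₂)))
      corner₀₀ : rank π x₀ t₀ ≡ rank π′ x₀ t₀
      corner₀₀ = agree-x₀ t₀ (agree (suc a) b 1+a+b≡m (<⇒≤ c₁<2^b) (<⇒≤ (double< c₂<2^a)))
      corner₁₁ : rank π x₁ t₁ ≡ rank π′ x₁ t₁
      corner₁₁ = subst (λ t → rank π x₁ t ≡ rank π′ x₁ t) (suc-*-2^suc c₂ b)
                   (agree a (suc b) a+1+b≡m (<⇒≤ (double< c₁<2^b)) c₂<2^a)
      corner₀₁ : rank π x₀ t₁ ≡ rank π′ x₀ t₁
      corner₀₁ = agree-x₀ t₁ (agree (suc a) b 1+a+b≡m (<⇒≤ c₁<2^b) (double< c₂<2^a))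

-- S₀, S₁ are the halves of S and T₀, T₁ those of T. For DWD π, one point of S₀ and one of S₁
-- are mapped into T, into different halves; Φ π D records whether the point of S₀ goes to T₁.
module PairAnalysis {m : ℕ} {π : Fin (2 ^ m) → Fin (2 ^ m)} (dwd : DWD m π) (D : Pair m) where
  open Pair D
  open Corner D using (lowerToUpper)

  lower-hits-T : ∃ λ i → InI a (2 * c₁) i × InI (suc b) c₂ (π i)
  lower-hits-T = dwd-exists dwd a (suc b) a+1+b≡m (<-trans (n<1+n _) (double< c₁<2^b)) c₂<2^a

  upper-hits-T : ∃ λ j → InI a (suc (2 * c₁)) j × InI (suc b) c₂ (π j)
  upper-hits-T = dwd-exists dwd a (suc b) a+1+b≡m (double< c₁<2^b) c₂<2^a

  S-half-unique : ∀ c {i j} → InI a c i → InI (suc b) c₂ (π i) → InI a c j → InI (suc b) c₂ (π j) → i ≡ j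
  S-half-unique c = dwd-unique dwd a (suc b) c c₂ a+1+b≡m

  T-half-unique : ∀ c {i j} → InI (suc a) c₁ i → InI b c (π i) → InI (suc a) c₁ j → InI b c (π j) → i ≡ j
  T-half-unique c = dwd-unique dwd (suc a) b c₁ c 1+a+b≡m

  private
    lower≢upper : ∀ {i j : Fin (2 ^ m)} → InI a (2 * c₁) i → InI a (suc (2 * c₁)) j → i ≢ j
    lower≢upper {i} {j} = lowerHalf≢upperHalf {a = a} {c₁} i j

    S∋lower : ∀ {i : Fin (2 ^ m)} → InI a (2 * c₁) i → InI (suc a) c₁ i
    S∋lower {i} = lowerHalf⇒InI {a = a} {c₁} i

    S∋upper : ∀ {i : Fin (2 ^ m)} → InI a (suc (2 * c₁)) i → InI (suc a) c₁ i
    S∋upper {i} = upperHalf⇒InI {a = a} {c₁} i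

  Φ⇒lower↦upper : T (Φ π D) → ∃ λ i → InI a (2 * c₁) i × InI b (suc (2 * c₂)) (π i)
  Φ⇒lower↦upper Φ-true =
    let (x , y , x<y , x∈S , y∈S , πx∈T , πy∈T , πy<πx) = Φ⇒inverted π D Φ-true
        x≢y : x ≢ y
        x≢y x≡y = <-irrefl (cong toℕ x≡y) x<y
        x∈S₀ : InI a (2 * c₁) x
        x∈S₀ = case-S (InI-halves {a = a} {c₁} x x∈S) (InI-halves {a = a} {c₁} y y∈S) x<y
                 (λ x∈S₁ y∈S₁ → x≢y (S-half-unique (suc (2 * c₁)) x∈S₁ πx∈T y∈S₁ πy∈T))
        πx∈T₁ : InI b (suc (2 * c₂)) (π x)
        πx∈T₁ = case-T (InI-halves {a = b} {c₂} (π x) πx∈T) (InI-halves {a = b} {c₂} (π y) πy∈T) πy<πx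
                 (λ πx∈T₀ πy∈T₀ → x≢y (T-half-unique (2 * c₂) x∈S πx∈T₀ y∈S πy∈T₀))
    in x , x∈S₀ , πx∈T₁
    where
    case-S : ∀ {x y} → InI a (2 * c₁) x ⊎ InI a (suc (2 * c₁)) x → InI a (2 * c₁) y ⊎ InI a (suc (2 * c₁)) y →
             toℕ x < toℕ y → (InI a (suc (2 * c₁)) x → InI a (suc (2 * c₁)) y → ⊥) →
             InI a (2 * c₁) x
    case-S (inj₁ x∈S₀) _ _ _ = x∈S₀
    case-S {x} {y} (inj₂ x∈S₁) (inj₁ y∈S₀) x<y _ =
      ⊥-elim (<-asym x<y (lowerHalf<upperHalf {a = a} {c₁} y x y∈S₀ x∈S₁))
    case-S (inj₂ x∈S₁) (inj₂ y∈S₁) _ both = ⊥-elim (both x∈S₁ y∈S₁)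
    case-T : ∀ {u v : Fin (2 ^ m)} →
             InI b (2 * c₂) u ⊎ InI b (suc (2 * c₂)) u → InI b (2 * c₂) v ⊎ InI b (suc (2 * c₂)) v →
             toℕ v < toℕ u → (InI b (2 * c₂) u → InI b (2 * c₂) v → ⊥) →
             InI b (suc (2 * c₂)) u
    case-T (inj₂ u∈T₁) _ _ _ = u∈T₁
    case-T {u} {v} (inj₁ u∈T₀) (inj₂ v∈T₁) v<u _ =
      ⊥-elim (<-asym v<u (lowerHalf<upperHalf {a = b} {c₂} u v u∈T₀ v∈T₁))
    case-T (inj₁ u∈T₀) (inj₁ v∈T₀) _ both = ⊥-elim (both u∈T₀ v∈T₀)

  lower↦upper⇒Φ : ∀ {i} → InI a (2 * c₁) i → InI b (suc (2 * c₂)) (π i) → T (Φ π D)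
  lower↦upper⇒Φ {i} i∈S₀ πi∈T₁ with upper-hits-T
  ... | j , j∈S₁ , πj∈T with InI-halves {a = b} {c₂} (π j) πj∈T
  ... | inj₂ πj∈T₁ =
    ⊥-elim (lower≢upper i∈S₀ j∈S₁ (T-half-unique (suc (2 * c₂)) (S∋lower i∈S₀) πi∈T₁ (S∋upper j∈S₁) πj∈T₁))
  ... | inj₁ πj∈T₀ = inverted⇒Φ π D
    ( lowerHalf<upperHalf {a = a} {c₁} i j i∈S₀ j∈S₁ , S∋lower i∈S₀ , S∋upper j∈S₁
    , upperHalf⇒InI {a = b} {c₂} (π i) πi∈T₁ , πj∈T
    , lowerHalf<upperHalf {a = b} {c₂} (π j) (π i) πj∈T₀ πi∈T₁ )

  lower-image : ∀ {i} → InI a (2 * c₁) i → InI (suc b) c₂ (π i) → (InI b (suc (2 * c₂)) (π i) ⇔ T (Φ π D))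
  lower-image {i} i∈S₀ πi∈T = mk⇔ (lower↦upper⇒Φ i∈S₀) λ Φ-true →
    let (i′ , i′∈S₀ , πi′∈T₁) = Φ⇒lower↦upper Φ-true
    in subst (λ k → InI b (suc (2 * c₂)) (π k))
             (S-half-unique (2 * c₁) i′∈S₀ (upperHalf⇒InI {a = b} {c₂} (π i′) πi′∈T₁) i∈S₀ πi∈T) πi′∈T₁

  upper-image : ∀ {j} → InI a (suc (2 * c₁)) j → InI (suc b) c₂ (π j) → (InI b (2 * c₂) (π j) ⇔ T (Φ π D))
  upper-image {j} j∈S₁ πj∈T = mk⇔ to from
    where
    to : InI b (2 * c₂) (π j) → T (Φ π D)
    to πj∈T₀ with lower-hits-T
    ... | i , i∈S₀ , πi∈T with InI-halves {a = b} {c₂} (π i) πi∈T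
    ... | inj₂ πi∈T₁ = lower↦upper⇒Φ i∈S₀ πi∈T₁
    ... | inj₁ πi∈T₀ =
      ⊥-elim (lower≢upper i∈S₀ j∈S₁ (T-half-unique (2 * c₂) (S∋lower i∈S₀) πi∈T₀ (S∋upper j∈S₁) πj∈T₀))
    from : T (Φ π D) → InI b (2 * c₂) (π j)
    from Φ-true =
      let (i , i∈S₀ , πi∈T₁) = Φ⇒lower↦upper Φ-true
      in [ id , (λ πj∈T₁ → ⊥-elim (lower≢upper i∈S₀ j∈S₁
                  (T-half-unique (suc (2 * c₂)) (S∋lower i∈S₀) πi∈T₁ (S∋upper j∈S₁) πj∈T₁))) ]′
           (InI-halves {a = b} {c₂} (π j) πj∈T)

  Φ⇔lowerToUpper≥1 : T (Φ π D) ⇔ 1 ≤ lowerToUpper π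
  Φ⇔lowerToUpper≥1 = mk⇔
    (λ Φ-true → let (i , i∈S₀ , πi∈T₁) = Φ⇒lower↦upper Φ-true
                in witness⇒count≥1 (unitPoint π a (2 * c₁) b (suc (2 * c₂)))
                     (T-∧⁺ (InI⇒inI? a (2 * c₁) i i∈S₀) (InI⇒inI? b (suc (2 * c₂)) (π i) πi∈T₁)))
    (λ 1≤count → let (i , i∈∧) = count≥1⇒witness (unitPoint π a (2 * c₁) b (suc (2 * c₂))) 1≤count
                     (i∈S₀ , πi∈T₁) = T-∧⁻ i∈∧
                 in lower↦upper⇒Φ (inI?⇒InI a (2 * c₁) i i∈S₀) (inI?⇒InI b (suc (2 * c₂)) (π i) πi∈T₁))

-- The pairs (S, T) with i ∈ S determine the binary digits of z i, from the leading one down.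
Φ-injective : ∀ {m} {z w : Fin (2 ^ m) → Fin (2 ^ m)} → DWD m z → DWD m w →
              (∀ D → Φ z D ≡ Φ w D) → z ≐ w
Φ-injective {m} {z} {w} dwd-z dwd-w Φ-z≡w i =
  let (c , zi∈ , wi∈) = common-block m 0 (+-identityʳ m)
  in Finₚ.toℕ-injective (trans (InI-zero {c = c} (z i) zi∈) (sym (InI-zero {c = c} (w i) wi∈)))
  where
  common-block : ∀ e k → e + k ≡ m → ∃ λ c → InI k c (z i) × InI k c (w i)
  common-block zero    k refl = 0 , InI-whole k (z i) , InI-whole k (w i)
  common-block (suc a) b 1+a+b≡m =
    [ (λ i∈S₀ → common-half-by-upper b c₂ (z i) (w i) zi∈T wi∈T
                  (⇔-trans (Z.lower-image i∈S₀ zi∈T) (⇔-trans same-Φ (⇔-sym (W.lower-image i∈S₀ wi∈T)))))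
    , (λ i∈S₁ → common-half-by-lower b c₂ (z i) (w i) zi∈T wi∈T
                  (⇔-trans (Z.upper-image i∈S₁ zi∈T) (⇔-trans same-Φ (⇔-sym (W.upper-image i∈S₁ wi∈T)))))
    ]′ (InI-halves {a = a} {c₁} i i∈S)
    where
    a+1+b≡m = trans (+-suc a b) 1+a+b≡m
    above = common-block a (suc b) a+1+b≡m
    c₂ = proj₁ above
    zi∈T = proj₁ (proj₂ above)
    wi∈T = proj₂ (proj₂ above)
    c₁ = proj₁ (InI-index (suc a) i)
    i∈S = proj₂ (InI-index (suc a) i)
    D : Pair m
    D = pair a b c₁ c₂ a+1+b≡m
      (subst (λ k → c₁ < 2 ^ k) (∸-complementˡ (suc a) b 1+a+b≡m)
        (InI⇒index< i (subst (suc a ≤_) 1+a+b≡m (m≤m+n (suc a) b)) (Finₚ.toℕ<n i) i∈S))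
      (subst (λ k → c₂ < 2 ^ k) (∸-complementʳ a (suc b) a+1+b≡m)
        (InI⇒index< (z i) (subst (suc b ≤_) a+1+b≡m (m≤n+m (suc b) a)) (Finₚ.toℕ<n (z i)) zi∈T))
    module Z = PairAnalysis dwd-z D
    module W = PairAnalysis dwd-w D
    same-Φ : T (Φ z D) ⇔ T (Φ w D)
    same-Φ = mk⇔ (subst T (Φ-z≡w D)) (subst T (sym (Φ-z≡w D)))

Φ-mono : ∀ {m} {z w : Fin (2 ^ m) → Fin (2 ^ m)} → DWD m z → DWD m w →
         (∀ x t → rank z x t ≤ rank w x t) → ∀ D → T (Φ z D) → T (Φ w D)
Φ-mono {z = z} {w} dwd-z dwd-w rank≤ D Φ-z =
  Equivalence.from W.Φ⇔lowerToUpper≥1 (≤-trans (Equivalence.to Z.Φ⇔lowerToUpper≥1 Φ-z) (begin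
    lowerToUpper z
      ≤⟨ m≤m+n (lowerToUpper z) _ ⟩
    lowerToUpper z + (R w ∸ R z)
      ≡⟨ lowerToUpper-shift (DWD⇒GridRanks dwd-z) (DWD⇒GridRanks dwd-w) (sym (m+[n∸m]≡n (rank≤ x₁ t₀))) ⟨
    lowerToUpper w
      ∎))
  where
  open Corner D
  open ≤-Reasoning
  module Z = PairAnalysis dwd-z D
  module W = PairAnalysis dwd-w D
  R : (Fin _ → Fin _) → ℕ
  R π = rank π x₁ t₀

-- Flipping a pair

-- i ∈ S₀ and j ∈ S₁ are the points mapped into T, with π i < π j. Swapping them changes ranks only
-- in the box ]i, j] × ]π i, π j], which lies inside S × T: it contains no grid point, and of the
-- corners (x₁, t₀) of all pairs only the one of D. So the swap keeps π DWD and flips only Φ at D.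
module Flip {m : ℕ} {π : Fin (2 ^ m) → Fin (2 ^ m)} (dwd : DWD m π) (D : Pair m) (¬Φ : ¬ T (Φ π D)) where
  open Pair D
  open PairAnalysis dwd D

  i j : Fin (2 ^ m)
  i = proj₁ lower-hits-T
  j = proj₁ upper-hits-T

  private
    i∈S₀ = proj₁ (proj₂ lower-hits-T)
    πi∈T = proj₂ (proj₂ lower-hits-T)
    j∈S₁ = proj₁ (proj₂ upper-hits-T)
    πj∈T = proj₂ (proj₂ upper-hits-T)
    i∈S = lowerHalf⇒InI {a = a} {c₁} i i∈S₀
    j∈S = upperHalf⇒InI {a = a} {c₁} j j∈S₁

    πi∈T₀ : InI b (2 * c₂) (π i)
    πi∈T₀ = [ id , (λ πi∈T₁ → ⊥-elim (¬Φ (Equivalence.to (lower-image i∈S₀ πi∈T) πi∈T₁))) ]′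
              (InI-halves {a = b} {c₂} (π i) πi∈T)

    πj∈T₁ : InI b (suc (2 * c₂)) (π j)
    πj∈T₁ = [ (λ πj∈T₀ → ⊥-elim (¬Φ (Equivalence.to (upper-image j∈S₁ πj∈T) πj∈T₀))) , id ]′
              (InI-halves {a = b} {c₂} (π j) πj∈T)

  i<j : toℕ i < toℕ j
  i<j = lowerHalf<upperHalf {a = a} {c₁} i j i∈S₀ j∈S₁

  πi<πj : toℕ (π i) < toℕ (π j)
  πi<πj = lowerHalf<upperHalf {a = b} {c₂} (π i) (π j) πi∈T₀ πj∈T₁

  π′ : Fin (2 ^ m) → Fin (2 ^ m)
  π′ = π ∘ transpose i j

  flip-longer : inv π < inv π′
  flip-longer = inv-transpose-ascent π i<j πi<πj

  private
    box-levels : ∀ k₁ k₂ e₁ e₂ → InBox π i j (e₁ * 2 ^ k₁) (e₂ * 2 ^ k₂) → k₁ ≤ a × k₂ ≤ b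
    box-levels k₁ k₂ e₁ e₂ (i<x , x≤j , πi<t , t≤πj) =
      level-between a c₁ i j i∈S j∈S e₁ k₁ i<x x≤j ,
      level-between b c₂ (π i) (π j) πi∈T πj∈T e₂ k₂ πi<t t≤πj

  grid-outside-box : ∀ k₁ k₂ e₁ e₂ → k₁ + k₂ ≡ m → ¬ InBox π i j (e₁ * 2 ^ k₁) (e₂ * 2 ^ k₂)
  grid-outside-box k₁ k₂ e₁ e₂ k₁+k₂≡m inBox =
    let (k₁≤a , k₂≤b) = box-levels k₁ k₂ e₁ e₂ inBox
    in <-irrefl (trans k₁+k₂≡m (sym a+1+b≡m)) (≤-<-trans (+-mono-≤ k₁≤a k₂≤b) (+-monoʳ-< a (n<1+n b)))

  flip-GridRanks : GridRanks m π′
  flip-GridRanks k₁ k₂ {e} c d k₁+k₂≡m e≤ c+d≡ =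
    trans (rank-transpose-outside π i<j πi<πj (grid-outside-box k₁ k₂ e c k₁+k₂≡m))
          (DWD⇒GridRanks dwd k₁ k₂ c d k₁+k₂≡m e≤ c+d≡)

  flip-DWD : DWD m π′
  flip-DWD = GridRanks⇒DWD flip-GridRanks

  private
    module Corners = Corner D

    corner-in-box : InBox π i j Corners.x₁ Corners.t₀
    corner-in-box = proj₂ i∈S₀ , proj₁ j∈S₁ , proj₂ πi∈T₀ , proj₁ πj∈T₁

    lowerToUpper-flip : Corners.lowerToUpper π′ ≡ Corners.lowerToUpper π + 1
    lowerToUpper-flip = Corners.lowerToUpper-shift (DWD⇒GridRanks dwd) flip-GridRanks
      (trans (rank-transpose-inside π i<j πi<πj corner-in-box) (+-comm 1 _))

  flip-Φ : T (Φ π′ D)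
  flip-Φ = Equivalence.from (PairAnalysis.Φ⇔lowerToUpper≥1 flip-DWD D)
             (subst (1 ≤_) (sym lowerToUpper-flip) (m≤n+m 1 _))

  flip-Φ-other : ∀ D′ → D′ ≢ D → Φ π′ D′ ≡ Φ π D′
  flip-Φ-other D′ D′≢D = T-ext
    (λ Φ′ → Equivalence.from (PairAnalysis.Φ⇔lowerToUpper≥1 dwd D′)
              (subst (1 ≤_) same (Equivalence.to (PairAnalysis.Φ⇔lowerToUpper≥1 flip-DWD D′) Φ′)))
    (λ Φ → Equivalence.from (PairAnalysis.Φ⇔lowerToUpper≥1 flip-DWD D′)
              (subst (1 ≤_) (sym same) (Equivalence.to (PairAnalysis.Φ⇔lowerToUpper≥1 dwd D′) Φ)))
    where
    module C′ = Corner D′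
    open Pair D′ using () renaming (a to a′; b to b′; c₁ to c₁′; c₂ to c₂′; a+1+b≡m to a′+1+b′≡m)
    corner′-in-box⇒≡ : InBox π i j C′.x₁ C′.t₀ → D′ ≡ D
    corner′-in-box⇒≡ inBox@(i<x , x≤j , πi<t , t≤πj) =
      let (a′≤a , b′≤b) = box-levels a′ b′ (suc (2 * c₁′)) (suc (2 * c₂′)) inBox
          a′+b′≡a+b = suc-injective (trans (sym (+-suc a′ b′)) (trans a′+1+b′≡m (trans (sym a+1+b≡m) (+-suc a b))))
          a′≡a = m≤o⇒n≤p⇒m+n≡o+p⇒m≡o a′≤a b′≤b a′+b′≡a+b
          b′≡b = +-cancelˡ-≡ a b′ b (trans (cong (_+ b′) (sym a′≡a)) a′+b′≡a+b)
      in Pair-≡ a′≡a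
           (odd-between a c₁ i j i∈S j∈S c₁′
              (subst (λ k → toℕ i < suc (2 * c₁′) * 2 ^ k) a′≡a i<x)
              (subst (λ k → suc (2 * c₁′) * 2 ^ k ≤ toℕ j) a′≡a x≤j))
           (odd-between b c₂ (π i) (π j) πi∈T πj∈T c₂′
              (subst (λ k → toℕ (π i) < suc (2 * c₂′) * 2 ^ k) b′≡b πi<t)
              (subst (λ k → suc (2 * c₂′) * 2 ^ k ≤ toℕ (π j)) b′≡b t≤πj))
    same : C′.lowerToUpper π′ ≡ C′.lowerToUpper π
    same = trans (C′.lowerToUpper-shift (DWD⇒GridRanks dwd) flip-GridRanks unchanged) (+-identityʳ _)
      where
      unchanged : rank π′ C′.x₁ C′.t₀ ≡ rank π C′.x₁ C′.t₀ + 0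
      unchanged = trans (rank-transpose-outside π i<j πi<πj (D′≢D ∘ corner′-in-box⇒≡)) (sym (+-identityʳ _))

-- The permutations x and y

divmod-unique : ∀ n .{{_ : NonZero n}} r q → r < n → (r + q * n) / n ≡ q × (r + q * n) % n ≡ r
divmod-unique n r q r<n = quotient , remainder
  where
  remainder : (r + q * n) % n ≡ r
  remainder = trans ([m+kn]%n≡m%n r q n) (m<n⇒m%n≡m r<n)
  quotient : (r + q * n) / n ≡ q
  quotient = *-cancelʳ-≡ _ q n (+-cancelˡ-≡ r _ _
    (trans (cong (_+ (r + q * n) / n * n) (sym remainder)) (sym (m≡m%n+[m/n]*n (r + q * n) n))))

rev-split : ∀ k j c d → d < 2 ^ k → rev (k + j) (d + c * 2 ^ k) ≡ rev k d * 2 ^ j + rev j c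
rev-split zero    j c zero    _ = cong (rev j) (*-identityʳ c)
rev-split zero    j c (suc d) (s≤s ())
rev-split (suc k) j c d d<2^k+1 = begin
  rev (k + j) (X / 2) + X % 2 * 2 ^ (k + j)
    ≡⟨ cong₂ (λ u v → rev (k + j) u + v * 2 ^ (k + j)) quotient remainder ⟩
  rev (k + j) (d / 2 + c * 2 ^ k) + d % 2 * 2 ^ (k + j)
    ≡⟨ cong₂ _+_ (rev-split k j c (d / 2) d/2<2^k) (cong (d % 2 *_) (^-distribˡ-+-* 2 k j)) ⟩
  rev k (d / 2) * 2 ^ j + rev j c + d % 2 * (2 ^ k * 2 ^ j)
    ≡⟨ regroup (rev k (d / 2)) (rev j c) (d % 2) (2 ^ k) (2 ^ j) ⟩
  (rev k (d / 2) + d % 2 * 2 ^ k) * 2 ^ j + rev j c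
    ∎
  where
  open ≡-Reasoning
  X = d + c * 2 ^ suc k
  X≡ : X ≡ d % 2 + (d / 2 + c * 2 ^ k) * 2
  X≡ = trans (cong (_+ c * 2 ^ suc k) (m≡m%n+[m/n]*n d 2)) (regroup′ (d % 2) (d / 2) c (2 ^ k))
    where
    regroup′ : ∀ r q c P → r + q * 2 + c * (2 * P) ≡ r + (q + c * P) * 2
    regroup′ = solve-∀
  quotient : X / 2 ≡ d / 2 + c * 2 ^ k
  quotient = trans (cong (_/ 2) X≡) (proj₁ (divmod-unique 2 (d % 2) (d / 2 + c * 2 ^ k) (m%n<n d 2)))
  remainder : X % 2 ≡ d % 2
  remainder = trans (cong (_% 2) X≡) (proj₂ (divmod-unique 2 (d % 2) (d / 2 + c * 2 ^ k) (m%n<n d 2)))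
  d/2<2^k : d / 2 < 2 ^ k
  d/2<2^k = m<n*o⇒m/o<n (subst (d <_) (*-comm 2 (2 ^ k)) d<2^k+1)
  regroup : ∀ A B C P Q → A * Q + B + C * (P * Q) ≡ (A + C * P) * Q + B
  regroup = solve-∀

rev-involutive : ∀ m i → i < 2 ^ m → rev m (rev m i) ≡ i
rev-involutive zero    zero    _ = refl
rev-involutive zero    (suc i) (s≤s ())
rev-involutive (suc m) i i<2^m+1 = begin
  rev (suc m) (rev m (i / 2) + i % 2 * 2 ^ m)
    ≡⟨ cong (λ k → rev k (rev m (i / 2) + i % 2 * 2 ^ m)) (+-comm 1 m) ⟩
  rev (m + 1) (rev m (i / 2) + i % 2 * 2 ^ m)
    ≡⟨ rev-split m 1 (i % 2) (rev m (i / 2)) (rev< m (i / 2)) ⟩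
  rev m (rev m (i / 2)) * 2 + rev 1 (i % 2)
    ≡⟨ cong₂ (λ u v → u * 2 + v) (rev-involutive m (i / 2) i/2<2^m) (rev-1 (i % 2) (m%n<n i 2)) ⟩
  i / 2 * 2 + i % 2
    ≡⟨ trans (+-comm (i / 2 * 2) (i % 2)) (sym (m≡m%n+[m/n]*n i 2)) ⟩
  i
    ∎
  where
  open ≡-Reasoning
  i/2<2^m : i / 2 < 2 ^ m
  i/2<2^m = m<n*o⇒m/o<n (subst (i <_) (*-comm 2 (2 ^ m)) i<2^m+1)
  rev-1 : ∀ d → d < 2 → rev 1 d ≡ d
  rev-1 zero          _ = refl
  rev-1 (suc zero)    _ = refl
  rev-1 (suc (suc d)) (s≤s (s≤s ()))

rev-even : ∀ a d → d < 2 ^ a → rev (suc a) d ≡ rev a d * 2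
rev-even a d d<2^a = begin
  rev (suc a) d                ≡⟨ cong (λ k → rev k d) (+-comm 1 a) ⟩
  rev (a + 1) d                ≡⟨ cong (rev (a + 1)) (+-identityʳ d) ⟨
  rev (a + 1) (d + 0 * 2 ^ a)  ≡⟨ rev-split a 1 0 d d<2^a ⟩
  rev a d * 2 + 0              ≡⟨ +-identityʳ _ ⟩
  rev a d * 2                  ∎
  where open ≡-Reasoning

toℕ-xPerm : ∀ m i → toℕ (xPerm m i) ≡ rev m (toℕ i)
toℕ-xPerm m i = Finₚ.toℕ-fromℕ< (rev< m (toℕ i))

xPerm-involutive : ∀ m i → xPerm m (xPerm m i) ≡ i
xPerm-involutive m i = Finₚ.toℕ-injective (begin
  toℕ (xPerm m (xPerm m i))   ≡⟨ toℕ-xPerm m (xPerm m i) ⟩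
  rev m (toℕ (xPerm m i))     ≡⟨ cong (rev m) (toℕ-xPerm m i) ⟩
  rev m (rev m (toℕ i))       ≡⟨ rev-involutive m (toℕ i) (Finₚ.toℕ<n i) ⟩
  toℕ i                       ∎)
  where open ≡-Reasoning

xPermutation : ∀ m → Permutation′ (2 ^ m)
xPermutation m = permutation (xPerm m) (xPerm m) (xPerm-involutive m) (xPerm-involutive m)

xPerm-block : ∀ k₁ k₂ c (i : Fin (2 ^ (k₁ + k₂))) → InI k₁ c i →
              ∃ λ d → d < 2 ^ k₁ × toℕ i ≡ d + c * 2 ^ k₁ × InI k₂ (rev k₁ d) (xPerm (k₁ + k₂) i)
xPerm-block k₁ k₂ c i i∈ =
  let (d , d< , i≡) = InI-offset⁻ k₁ c i i∈
  in d , d< , i≡ , InI-offset k₂ (rev k₁ d) (rev k₂ c) (xPerm (k₁ + k₂) i) (rev< k₂ c)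
       (trans (toℕ-xPerm (k₁ + k₂) i) (trans (cong (rev (k₁ + k₂)) i≡)
         (trans (rev-split k₁ k₂ c d d<) (+-comm (rev k₁ d * 2 ^ k₂) (rev k₂ c)))))

DWD-xPerm : ∀ m → DWD m (xPerm m)
DWD-xPerm .(k₁ + k₂) k₁ k₂ refl c₁ c₂ c₁< c₂< = i , (i∈ , xi∈) , unique
  where
  m = k₁ + k₂
  c₂<2^k₁ : c₂ < 2 ^ k₁
  c₂<2^k₁ = subst (λ k → c₂ < 2 ^ k) (∸-complementʳ k₁ k₂ refl) c₂<
  c₁<2^k₂ : c₁ < 2 ^ k₂
  c₁<2^k₂ = subst (λ k → c₁ < 2 ^ k) (∸-complementˡ k₁ k₂ refl) c₁<
  d = rev k₁ c₂
  i<2^m : d + c₁ * 2 ^ k₁ < 2 ^ m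
  i<2^m = begin-strict
    d + c₁ * 2 ^ k₁        <⟨ +-monoˡ-< (c₁ * 2 ^ k₁) (rev< k₁ c₂) ⟩
    suc c₁ * 2 ^ k₁        ≤⟨ *-monoˡ-≤ (2 ^ k₁) c₁<2^k₂ ⟩
    2 ^ k₂ * 2 ^ k₁        ≡⟨ *-comm (2 ^ k₂) (2 ^ k₁) ⟩
    2 ^ k₁ * 2 ^ k₂        ≡⟨ 2^-+ k₁ k₂ refl ⟩
    2 ^ m                  ∎
    where open ≤-Reasoning
  i : Fin (2 ^ m)
  i = fromℕ< i<2^m
  i∈ : InI k₁ c₁ i
  i∈ = InI-offset k₁ c₁ d i (rev< k₁ c₂) (Finₚ.toℕ-fromℕ< i<2^m)
  xi∈ : InI k₂ c₂ (xPerm m i)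
  xi∈ = let (d′ , _ , i≡ , xi∈′) = xPerm-block k₁ k₂ c₁ i i∈
            d′≡d = +-cancelʳ-≡ (c₁ * 2 ^ k₁) d′ d (trans (sym i≡) (Finₚ.toℕ-fromℕ< i<2^m))
        in subst (λ c → InI k₂ c (xPerm m i))
                 (trans (cong (rev k₁) d′≡d) (rev-involutive k₁ c₂ c₂<2^k₁)) xi∈′
  unique : ∀ {i′} → InI k₁ c₁ i′ × InI k₂ c₂ (xPerm m i′) → i ≡ i′
  unique {i′} (i′∈ , xi′∈) =
    let (d′ , d′< , i′≡ , xi′∈′) = xPerm-block k₁ k₂ c₁ i′ i′∈
        revd′≡c₂ = InI-index-unique {k = k₂} (xPerm m i′) xi′∈′ xi′∈
        d≡d′ = trans (cong (rev k₁) (sym revd′≡c₂)) (rev-involutive k₁ d′ d′<)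
    in Finₚ.toℕ-injective (trans (Finₚ.toℕ-fromℕ< i<2^m) (trans (cong (_+ c₁ * 2 ^ k₁) d≡d′) (sym i′≡)))

-- i ∈ S₀ has a 0 in the binary digit of weight 2^a, so its reversal lies in a block of even index.
xPerm-no-lower↦upper : ∀ {m} a b → suc a + b ≡ m → ∀ c₁ c₂ (i : Fin (2 ^ m)) →
                       InI a (2 * c₁) i → ¬ InI b (suc (2 * c₂)) (xPerm m i)
xPerm-no-lower↦upper a b refl c₁ c₂ i i∈S₀ xi∈T₁ =
  even≢odd (rev a d) c₂
    (trans (*-comm 2 (rev a d)) (InI-index-unique {k = b} (xPerm (suc a + b) i) xi∈even xi∈T₁))
  where
  offset = InI-offset⁻ a (2 * c₁) i i∈S₀
  d = proj₁ offset
  d<2^a = proj₁ (proj₂ offset)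
  xi≡ : toℕ (xPerm (suc a + b) i) ≡ rev b c₁ + rev a d * 2 * 2 ^ b
  xi≡ = begin
    toℕ (xPerm (suc a + b) i)
      ≡⟨ toℕ-xPerm (suc a + b) i ⟩
    rev (suc a + b) (toℕ i)
      ≡⟨ cong (rev (suc a + b)) (trans (proj₂ (proj₂ offset)) (cong (d +_) (sym (*-2^suc c₁ a)))) ⟩
    rev (suc a + b) (d + c₁ * 2 ^ suc a)
      ≡⟨ rev-split (suc a) b c₁ d (<-≤-trans d<2^a (m≤m+n (2 ^ a) _)) ⟩
    rev (suc a) d * 2 ^ b + rev b c₁
      ≡⟨ cong (λ r → r * 2 ^ b + rev b c₁) (rev-even a d d<2^a) ⟩
    rev a d * 2 * 2 ^ b + rev b c₁
      ≡⟨ +-comm _ (rev b c₁) ⟩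
    rev b c₁ + rev a d * 2 * 2 ^ b
      ∎
    where open ≡-Reasoning
  xi∈even : InI b (rev a d * 2) (xPerm (suc a + b) i)
  xi∈even = InI-offset b (rev a d * 2) (rev b c₁) (xPerm (suc a + b) i) (rev< b c₁) xi≡

Φ-xPerm : ∀ {m} (D : Pair m) → ¬ T (Φ (xPerm m) D)
Φ-xPerm {m} D Φ-true =
  let (i , i∈S₀ , xi∈T₁) = PairAnalysis.Φ⇒lower↦upper (DWD-xPerm m) D Φ-true
  in xPerm-no-lower↦upper a b 1+a+b≡m c₁ c₂ i i∈S₀ xi∈T₁
  where open Pair D

opposite-InI : ∀ {m} k c (i : Fin (2 ^ m)) → k ≤ m → InI k c i → InI k (2 ^ (m ∸ k) ∸ suc c) (opposite i)
opposite-InI {m} k c i k≤m i∈ = InI-offset k c′ d′ (opposite i) d′<2^k (begin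
  toℕ (opposite i)                               ≡⟨ Finₚ.opposite-prop i ⟩
  2 ^ m ∸ suc (toℕ i)                            ≡⟨ cong (_∸ suc (toℕ i)) 2^m≡ ⟩
  d′ + c′ * 2 ^ k + suc (toℕ i) ∸ suc (toℕ i)    ≡⟨ m+n∸n≡m (d′ + c′ * 2 ^ k) (suc (toℕ i)) ⟩
  d′ + c′ * 2 ^ k                                ∎)
  where
  open ≡-Reasoning
  offset = InI-offset⁻ k c i i∈
  d = proj₁ offset
  d<2^k = proj₁ (proj₂ offset)
  c<Q : c < 2 ^ (m ∸ k)
  c<Q = InI⇒index< i k≤m (Finₚ.toℕ<n i) i∈
  c′ = 2 ^ (m ∸ k) ∸ suc c
  d′ = 2 ^ k ∸ suc d
  d′<2^k : d′ < 2 ^ k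
  d′<2^k = ∸-monoʳ-< {2 ^ k} (s≤s z≤n) d<2^k
  2^m≡ : 2 ^ m ≡ d′ + c′ * 2 ^ k + suc (toℕ i)
  2^m≡ = begin
    2 ^ m
      ≡⟨ 2^-+ (m ∸ k) k (m∸n+n≡m k≤m) ⟨
    2 ^ (m ∸ k) * 2 ^ k
      ≡⟨ cong (_* 2 ^ k) (m∸n+n≡m c<Q) ⟨
    (c′ + suc c) * 2 ^ k
      ≡⟨ *-distribʳ-+ (2 ^ k) c′ (suc c) ⟩
    c′ * 2 ^ k + (2 ^ k + c * 2 ^ k)
      ≡⟨ cong (λ P → c′ * 2 ^ k + (P + c * 2 ^ k)) (m∸n+n≡m d<2^k) ⟨
    c′ * 2 ^ k + (d′ + suc d + c * 2 ^ k)
      ≡⟨ regroup (c′ * 2 ^ k) d′ d (c * 2 ^ k) ⟩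
    d′ + c′ * 2 ^ k + suc (d + c * 2 ^ k)
      ≡⟨ cong (λ x → d′ + c′ * 2 ^ k + suc x) (proj₂ (proj₂ offset)) ⟨
    d′ + c′ * 2 ^ k + suc (toℕ i)
      ∎
    where
    regroup : ∀ x y z w → x + (y + suc z + w) ≡ y + x + suc (z + w)
    regroup = solve-∀

∸-reflect : ∀ {c Q} → c < Q → Q ∸ suc (Q ∸ suc c) ≡ c
∸-reflect {c} {Q} c<Q = begin
  Q ∸ suc (Q ∸ suc c)                      ≡⟨ cong (_∸ suc (Q ∸ suc c)) (m∸n+n≡m c<Q) ⟨
  (Q ∸ suc c) + suc c ∸ suc (Q ∸ suc c)    ≡⟨ cong (_∸ suc (Q ∸ suc c)) (+-suc (Q ∸ suc c) c) ⟩
  suc (Q ∸ suc c) + c ∸ suc (Q ∸ suc c)    ≡⟨ m+n∸m≡n (suc (Q ∸ suc c)) c ⟩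
  c                                        ∎
  where open ≡-Reasoning

DWD-∘opposite : ∀ {m} {π : Fin (2 ^ m) → Fin (2 ^ m)} → DWD m π → DWD m (π ∘ opposite)
DWD-∘opposite {m} {π} dwd k₁ k₂ k₁+k₂≡m c₁ c₂ c₁< c₂< =
  opposite j , (oj∈ , subst (InI k₂ c₂ ∘ π) (sym (Finₚ.opposite-involutive j)) πj∈) , unique′
  where
  Q = 2 ^ (m ∸ k₁)
  k₁≤m = subst (k₁ ≤_) k₁+k₂≡m (m≤m+n k₁ k₂)
  mirrored = dwd k₁ k₂ k₁+k₂≡m (Q ∸ suc c₁) c₂ (∸-monoʳ-< {Q} (s≤s z≤n) c₁<) c₂<
  j = proj₁ mirrored
  j∈ = proj₁ (proj₁ (proj₂ mirrored))
  πj∈ = proj₂ (proj₁ (proj₂ mirrored))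
  oj∈ : InI k₁ c₁ (opposite j)
  oj∈ = subst (λ c → InI k₁ c (opposite j)) (∸-reflect c₁<) (opposite-InI k₁ (Q ∸ suc c₁) j k₁≤m j∈)
  unique′ : ∀ {i} → InI k₁ c₁ i × InI k₂ c₂ (π (opposite i)) → opposite j ≡ i
  unique′ {i} (i∈ , πoi∈) =
    trans (cong opposite (proj₂ (proj₂ mirrored) (opposite-InI k₁ c₁ i k₁≤m i∈ , πoi∈)))
          (Finₚ.opposite-involutive i)

DWD-yPerm : ∀ m → DWD m (yPerm m)
DWD-yPerm m = DWD-∘opposite (DWD-xPerm m)

-- opposite maps S₁ onto a lower half, where xPerm-no-lower↦upper applies.
yPerm-no-upper↦upper : ∀ {m} a b → a + suc b ≡ m → ∀ c₁ c₂ (j : Fin (2 ^ m)) →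
                       InI a (suc (2 * c₁)) j → ¬ InI b (suc (2 * c₂)) (yPerm m j)
yPerm-no-upper↦upper {m} a b a+1+b≡m c₁ c₂ j j∈S₁ =
  xPerm-no-lower↦upper a b (trans (sym (+-suc a b)) a+1+b≡m) (2 ^ b ∸ suc c₁) c₂ (opposite j)
    (subst (λ c → InI a c (opposite j)) mirrored-index
      (opposite-InI a (suc (2 * c₁)) j (subst (a ≤_) a+1+b≡m (m≤m+n a (suc b))) j∈S₁))
  where
  mirrored-index : 2 ^ (m ∸ a) ∸ suc (suc (2 * c₁)) ≡ 2 * (2 ^ b ∸ suc c₁)
  mirrored-index = begin
    2 ^ (m ∸ a) ∸ suc (suc (2 * c₁))
      ≡⟨ cong (λ k → 2 ^ k ∸ suc (suc (2 * c₁))) (∸-complementˡ a (suc b) a+1+b≡m) ⟩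
    2 * 2 ^ b ∸ suc (suc (2 * c₁))
      ≡⟨ cong (2 * 2 ^ b ∸_) (*-suc 2 c₁) ⟨
    2 * 2 ^ b ∸ 2 * suc c₁
      ≡⟨ *-distribˡ-∸ 2 (2 ^ b) (suc c₁) ⟨
    2 * (2 ^ b ∸ suc c₁)
      ∎
    where open ≡-Reasoning

Φ-yPerm : ∀ {m} (D : Pair m) → T (Φ (yPerm m) D)
Φ-yPerm {m} D = decidable-stable (T? (Φ (yPerm m) D)) λ ¬Φ →
  let (j , j∈S₁ , yj∈T) = upper-hits-T
      yj∈T₁ = [ (λ yj∈T₀ → ⊥-elim (¬Φ (Equivalence.to (upper-image j∈S₁ yj∈T) yj∈T₀))) , id ]′
                (InI-halves {a = b} {c₂} (yPerm m j) yj∈T)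
  in yPerm-no-upper↦upper a b a+1+b≡m c₁ c₂ j j∈S₁ yj∈T₁
  where
  open Pair D
  open PairAnalysis (DWD-yPerm m) D

-- Reaching every pattern

module _ {m : ℕ} (B : Pair m → Bool) where

  Reachable : Permutation′ (2 ^ m) → Set
  Reachable z = ∃ λ z′ → DWD m (z′ ⟨$⟩ʳ_) × (z ⟨$⟩ʳ_) ≤B (z′ ⟨$⟩ʳ_) × (∀ D → Φ (z′ ⟨$⟩ʳ_) D ≡ B D)

  private
    ∈-tail : ∀ {D D′ : Pair m} {L} → D′ ∈ D ∷ L → D′ ≢ D → D′ ∈ L
    ∈-tail (here D′≡D)  D′≢D = ⊥-elim (D′≢D D′≡D)
    ∈-tail (there D′∈L) _    = D′∈L

  reach : ∀ (L : List (Pair m)) (z : Permutation′ (2 ^ m)) → DWD m (z ⟨$⟩ʳ_) →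
          (∀ D → T (Φ (z ⟨$⟩ʳ_) D) → T (B D)) → (∀ D → Φ (z ⟨$⟩ʳ_) D ≢ B D → D ∈ L) → Reachable z
  reach [] z dwd _ disagreements⊆[] =
    z , dwd , done (λ _ → refl) ,
    λ D → decidable-stable (Φ (z ⟨$⟩ʳ_) D Boolₚ.≟ B D) (λ differ → absurd (disagreements⊆[] D differ))
    where
    absurd : ∀ {D} → D ∈ [] → ⊥
    absurd ()
  reach (D ∷ L) z dwd Φ⇒B disagreements⊆D∷L = by-cases (Φ (z ⟨$⟩ʳ_) D Boolₚ.≟ B D)
    where
    by-cases : Dec (Φ (z ⟨$⟩ʳ_) D ≡ B D) → Reachable z
    by-cases (yes agree) = reach L z dwd Φ⇒B λ D′ differ →
      ∈-tail (disagreements⊆D∷L D′ differ) (λ { refl → differ agree })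
    by-cases (no differ) =
      let (z′ , dwd′ , z₁≤z′ , Φ′≡B) = reach L z₁ F.flip-DWD Φ₁⇒B disagreements₁⊆L
      in z′ , dwd′ , step F.i F.j F.flip-longer z₁≤z′ , Φ′≡B
      where
      ¬Φ : ¬ T (Φ (z ⟨$⟩ʳ_) D)
      ¬Φ Φ-true = differ (trans (T-≡true Φ-true) (sym (T-≡true (Φ⇒B D Φ-true))))
      BD : T (B D)
      BD = decidable-stable (T? (B D)) λ ¬BD → differ (trans (¬T-≡false ¬Φ) (sym (¬T-≡false ¬BD)))
      module F = Flip dwd D ¬Φ
      z₁ : Permutation′ (2 ^ m)
      z₁ = transposition F.i F.j ∘ₚ z
      Φ₁⇒B : ∀ D′ → T (Φ (z₁ ⟨$⟩ʳ_) D′) → T (B D′)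
      Φ₁⇒B D′ Φ₁ with D′ ≟ᴾ D
      ... | yes refl  = BD
      ... | no  D′≢D = Φ⇒B D′ (subst T (F.flip-Φ-other D′ D′≢D) Φ₁)
      disagreements₁⊆L : ∀ D′ → Φ (z₁ ⟨$⟩ʳ_) D′ ≢ B D′ → D′ ∈ L
      disagreements₁⊆L D′ differ₁ with D′ ≟ᴾ D
      ... | yes refl  = ⊥-elim (differ₁ (trans (T-≡true F.flip-Φ) (sym (T-≡true BD))))
      ... | no  D′≢D =
        ∈-tail (disagreements⊆D∷L D′ (differ₁ ∘ trans (F.flip-Φ-other D′ D′≢D))) D′≢D

module Enumeration (m : ℕ) where

  private
    P = 2 ^ m
    instance
      P≢0 : NonZero P
      P≢0 = m^n≢0 2 m
    2^≢0 : ∀ k → NonZero (2 ^ k)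
    2^≢0 k = m^n≢0 2 k

  -- A mixed-radix numeral with digits c₂ < 2^a, c₁ < 2^b and a ≤ m.
  value : Pair (suc m) → ℕ
  value D = c₂ + c₁ * 2 ^ a + a * P
    where open Pair D

  private
    a+b≡m : ∀ D → Pair.a D + Pair.b D ≡ m
    a+b≡m D = suc-injective (trans (sym (+-suc (Pair.a D) (Pair.b D))) (Pair.a+1+b≡m D))

    inner< : ∀ D → Pair.c₂ D + Pair.c₁ D * 2 ^ Pair.a D < P
    inner< D = begin-strict
      c₂ + c₁ * 2 ^ a    <⟨ +-monoˡ-< (c₁ * 2 ^ a) c₂<2^a ⟩
      suc c₁ * 2 ^ a     ≤⟨ *-monoˡ-≤ (2 ^ a) c₁<2^b ⟩
      2 ^ b * 2 ^ a      ≡⟨ 2^-+ b a (trans (+-comm b a) (a+b≡m D)) ⟩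
      P                  ∎
      where
      open Pair D
      open ≤-Reasoning

  value< : ∀ D → value D < suc m * P
  value< D = <-≤-trans (+-monoˡ-< (Pair.a D * P) (inner< D))
                       (*-monoˡ-≤ P (s≤s (subst (Pair.a D ≤_) (a+b≡m D) (m≤m+n _ _))))

  toIndex : Pair (suc m) → Fin (suc m * P)
  toIndex D = fromℕ< (value< D)

  fromIndex : Fin (suc m * P) → Pair (suc m)
  fromIndex j = pair a b c₁ c₂ a+1+b≡1+m c₁< c₂<
    where
    a = toℕ j / P
    a≤m : a ≤ m
    a≤m = ≤-pred (m<n*o⇒m/o<n (Finₚ.toℕ<n j))
    b = m ∸ a
    a+1+b≡1+m : a + suc b ≡ suc m
    a+1+b≡1+m = trans (+-suc a b) (cong suc (m+[n∸m]≡n a≤m))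
    r = toℕ j % P
    c₁ = _/_ r (2 ^ a) {{2^≢0 a}}
    c₂ = _%_ r (2 ^ a) {{2^≢0 a}}
    c₁< : c₁ < 2 ^ b
    c₁< = m<n*o⇒m/o<n {{2^≢0 a}} (subst (r <_) (sym (2^-+ b a (m∸n+n≡m a≤m))) (m%n<n (toℕ j) P))
    c₂< : c₂ < 2 ^ a
    c₂< = m%n<n r (2 ^ a) {{2^≢0 a}}

  fromIndex-toIndex : ∀ D → fromIndex (toIndex D) ≡ D
  fromIndex-toIndex D = Pair-≡ a≡ c₁≡ c₂≡
    where
    open Pair D
    value≡ : toℕ (toIndex D) ≡ value D
    value≡ = Finₚ.toℕ-fromℕ< (value< D)
    a≡ : toℕ (toIndex D) / P ≡ a
    a≡ = trans (cong (_/ P) value≡) (proj₁ (divmod-unique P (c₂ + c₁ * 2 ^ a) a (inner< D)))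
    r≡ : toℕ (toIndex D) % P ≡ c₂ + c₁ * 2 ^ a
    r≡ = trans (cong (_% P) value≡) (proj₂ (divmod-unique P (c₂ + c₁ * 2 ^ a) a (inner< D)))
    c₁≡ : Pair.c₁ (fromIndex (toIndex D)) ≡ c₁
    c₁≡ = trans (cong₂ (λ r k → _/_ r (2 ^ k) {{2^≢0 k}}) r≡ a≡)
                (proj₁ (divmod-unique (2 ^ a) {{2^≢0 a}} c₂ c₁ c₂<2^a))
    c₂≡ : Pair.c₂ (fromIndex (toIndex D)) ≡ c₂
    c₂≡ = trans (cong₂ (λ r k → _%_ r (2 ^ k) {{2^≢0 k}}) r≡ a≡)
                (proj₂ (divmod-unique (2 ^ a) {{2^≢0 a}} c₂ c₁ c₂<2^a))

  toIndex-fromIndex : ∀ j → toIndex (fromIndex j) ≡ j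
  toIndex-fromIndex j = Finₚ.toℕ-injective (begin
    toℕ (toIndex (fromIndex j))
      ≡⟨ Finₚ.toℕ-fromℕ< (value< (fromIndex j)) ⟩
    _%_ r (2 ^ a) {{2^≢0 a}} + _/_ r (2 ^ a) {{2^≢0 a}} * 2 ^ a + a * P
      ≡⟨ cong (_+ a * P) (m≡m%n+[m/n]*n r (2 ^ a) {{2^≢0 a}}) ⟨
    r + a * P
      ≡⟨ m≡m%n+[m/n]*n (toℕ j) P ⟨
    toℕ j
      ∎)
    where
    open ≡-Reasoning
    a = toℕ j / P
    r = toℕ j % P

allPairs : ∀ m → List (Pair m)
allPairs zero    = []
allPairs (suc m) = map (Enumeration.fromIndex m) (allFin _)

∈-allPairs : ∀ {m} (D : Pair m) → D ∈ allPairs m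
∈-allPairs {zero}  D = ⊥-elim (m+1+n≢0 (Pair.a D) (Pair.a+1+b≡m D))
∈-allPairs {suc m} D =
  subst (_∈ allPairs (suc m)) (fromIndex-toIndex D) (∈-map⁺ fromIndex (∈-allFin (toIndex D)))
  where open Enumeration m

module _ {m : ℕ} where

  reach-all : ∀ (B : Pair m → Bool) (z : Permutation′ (2 ^ m)) → DWD m (z ⟨$⟩ʳ_) →
              (∀ D → T (Φ (z ⟨$⟩ʳ_) D) → T (B D)) → Reachable B z
  reach-all B z dwd Φ⇒B = reach B (allPairs m) z dwd Φ⇒B (λ D _ → ∈-allPairs D)

  reach-from-x : ∀ (B : Pair m → Bool) → Reachable B (xPermutation m)
  reach-from-x B = reach-all B (xPermutation m) (DWD-xPerm m) (λ D Φx → ⊥-elim (Φ-xPerm D Φx))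

  DWD⇒interval : ∀ (z : Permutation′ (2 ^ m)) → DWD m (z ⟨$⟩ʳ_) →
                 xPerm m ≤B (z ⟨$⟩ʳ_) × (z ⟨$⟩ʳ_) ≤B yPerm m
  DWD⇒interval z dwd =
    let (z₁ , dwd₁ , x≤z₁ , Φ₁≡Φ) = reach-from-x (Φ (z ⟨$⟩ʳ_))
        (z₂ , dwd₂ , z≤z₂ , Φ₂≡true) = reach-all (λ _ → true) z dwd (λ _ _ → _)
    in ≤B-respʳ-≐ x≤z₁ (Φ-injective dwd₁ dwd Φ₁≡Φ) ,
       ≤B-respʳ-≐ z≤z₂ (Φ-injective dwd₂ (DWD-yPerm m) (λ D → trans (Φ₂≡true D) (sym (T-≡true (Φ-yPerm D)))))

  interval⇒DWD : ∀ {f : Fin (2 ^ m) → Fin (2 ^ m)} → xPerm m ≤B f → f ≤B yPerm m → DWD m f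
  interval⇒DWD {f} x≤f f≤y = GridRanks⇒DWD λ k₁ k₂ {c₁} c₂ d k₁+k₂≡m c₁≤ c₂+d≡ →
    let x = c₁ * 2 ^ k₁
        t = c₂ * 2 ^ k₂
    in ≤-antisym
      (begin
        rank f x t         ≤⟨ ≤B⇒rank≤ f≤y x t ⟩
        rank (yPerm m) x t ≡⟨ DWD⇒GridRanks (DWD-yPerm m) k₁ k₂ c₂ d k₁+k₂≡m c₁≤ c₂+d≡ ⟩
        c₁ * d             ∎)
      (begin
        c₁ * d             ≡⟨ DWD⇒GridRanks (DWD-xPerm m) k₁ k₂ c₂ d k₁+k₂≡m c₁≤ c₂+d≡ ⟨
        rank (xPerm m) x t ≤⟨ ≤B⇒rank≤ x≤f x t ⟩
        rank f x t         ∎)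
    where open ≤-Reasoning

module _ {A X Y : Set} {_≈_ _≲_ : A → A → Set} {F : A → Y → Bool} {G : A → X → Bool}
         (to : X → Y) (from : Y → X) (to-from : ∀ y → to (from y) ≡ y) (from-to : ∀ x → from (to x) ≡ x)
         (G≗F∘to : ∀ a x → G a x ≡ F a (to x)) where

  precompose-isOrderIsomorphism : IsOrderIsomorphism _≈_ (_≈F_ {Y}) _≲_ (_≤F_ {Y}) F →
                                  IsOrderIsomorphism _≈_ (_≈F_ {X}) _≲_ (_≤F_ {X}) G
  precompose-isOrderIsomorphism F-iso = record
    { isOrderMonomorphism = record
      { isOrderHomomorphism = record
        { cong = λ a≈b x → trans (G≗F∘to _ x) (trans (F.cong a≈b (to x)) (sym (G≗F∘to _ x)))
        ; mono = λ a≲b x → subst₂ Bool._≤_ (sym (G≗F∘to _ x)) (sym (G≗F∘to _ x)) (F.mono a≲b (to x))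
        }
      ; injective = λ Ga≈Gb → F.injective (λ y → subst (λ y′ → F _ y′ ≡ F _ y′) (to-from y)
                                (trans (sym (G≗F∘to _ (from y))) (trans (Ga≈Gb (from y)) (G≗F∘to _ (from y)))))
      ; cancel = λ Ga≤Gb → F.cancel (λ y → subst (λ y′ → F _ y′ Bool.≤ F _ y′) (to-from y)
                             (subst₂ Bool._≤_ (G≗F∘to _ (from y)) (G≗F∘to _ (from y)) (Ga≤Gb (from y))))
      }
    ; surjective = λ B →
        let (a , onto) = F.surjective (B ∘′ from)
        in a , λ z≈a x → trans (G≗F∘to _ x) (trans (onto z≈a (to x)) (cong B (from-to x)))
    }
    where module F = IsOrderIsomorphism F-iso

module _ {m : ℕ} where

  private
    ⟦_⟧ : Interval m → Fin (2 ^ m) → Fin (2 ^ m)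
    ⟦ z , _ ⟧ = z ⟨$⟩ʳ_

    dwd : ∀ I → DWD m ⟦ I ⟧
    dwd (_ , x≤z , z≤y) = interval⇒DWD x≤z z≤y

  Φᴵ : Interval m → Pair m → Bool
  Φᴵ I = Φ ⟦ I ⟧

  Φᴵ-isOrderIsomorphism : IsOrderIsomorphism (_≈I_ {m}) (_≈F_ {Pair m}) (_≤I_ {m}) (_≤F_ {Pair m}) Φᴵ
  Φᴵ-isOrderIsomorphism = record
    { isOrderMonomorphism = record
      { isOrderHomomorphism = record
        { cong = λ I≈J → Φ-cong I≈J
        ; mono = λ {I} {J} I≤J D → T⇒≤ (Φ-mono (dwd I) (dwd J) (≤B⇒rank≤ I≤J) D)
        }
      ; injective = λ {I} {J} → Φ-injective (dwd I) (dwd J)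
      ; cancel = λ {I} {J} Φ≤Φ →
          let (z′ , dwd′ , I≤z′ , Φ′≡) = reach-all (Φᴵ J) (proj₁ I) (dwd I) (λ D → ≤⇒T (Φ≤Φ D))
          in ≤B-respʳ-≐ I≤z′ (Φ-injective dwd′ (dwd J) Φ′≡)
      }
    ; surjective = λ B →
        let (z′ , dwd′ , _ , Φ′≡B) = reach-from-x B
        in (z′ , DWD⇒interval z′ dwd′) , λ J≈I D → trans (Φ-cong J≈I D) (Φ′≡B D)
    }

φ-isOrderIsomorphism : ∀ {m} → IsOrderIsomorphism (_≈I_ {m}) (_≈F_ {CPair m}) (_≤I_ {m}) (_≤F_ {CPair m}) (φ m)
φ-isOrderIsomorphism {m} =
  precompose-isOrderIsomorphism toPair fromPair toPair-fromPair fromPair-toPair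
    (λ I p → cong (φ₀ m (proj₁ I ⟨$⟩ʳ_)) (sym (fromPair-toPair p))) Φᴵ-isOrderIsomorphism

theorem2p21 : (m : ℕ) → 1 ≤ m →
    ((z : Permutation′ (2 ^ m)) →
       DWD m (z ⟨$⟩ʳ_) ⇔ (xPerm m ≤B (z ⟨$⟩ʳ_) × (z ⟨$⟩ʳ_) ≤B yPerm m))
    × IsOrderIsomorphism (_≈I_ {m}) (_≈F_ {CPair m}) (_≤I_ {m}) (_≤F_ {CPair m}) (φ m)
    × ∃ (λ (f : Interval m → (Fin (m * 2 ^ (m ∸ 1)) → Bool)) →
           IsOrderIsomorphism (_≈I_ {m}) (_≈F_ {Fin (m * 2 ^ (m ∸ 1))}) (_≤I_ {m}) (_≤F_ {Fin (m * 2 ^ (m ∸ 1))}) f)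
theorem2p21 zero    ()
theorem2p21 (suc m) _ =
  (λ z → mk⇔ (DWD⇒interval z) (uncurry interval⇒DWD)) ,
  φ-isOrderIsomorphism ,
  _ , precompose-isOrderIsomorphism fromIndex toIndex fromIndex-toIndex toIndex-fromIndex
        (λ _ _ → refl) Φᴵ-isOrderIsomorphism
  where open Enumeration m
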